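{- We have $$\begin{aligned} \langle z^n\rangle& \alpha^{f+1}\left(\frac { z} {1-yz}\right)^{f-t} \frac {\left(\frac { z} {1-yz}\right)^{t} -\left( zM(z)\right)^{t}} {x+\alpha zM(z)} \frac {\left(zM(z)\right)^{t+1}} {1-\alpha z^2M^2(z)}\\ &=\sum_{\substack{c,d,e\ge0\\ c+d+2e-f+t=n}} x^cy^d\alpha^{e} \left(\frac {(n-1)!\,(n-d-f-1)!} {(c+e-f)\,c!\,d!\,(n-d-1)!\,(e-f+t-1)!\,(e-f-1)!} -\frac {(n-1)!\,(n-d-f+t-1)!} {(c+e-f)\,c!\,d!\,(n-d-1)!\,(e-f+2t-1)!\,(e-f-1)!}\right). \end{aligned}$$
   Context: $M(z)$ is the formal power series in $z$ (with coefficients polynomials in $x,y,\alpha$) satisfying $M(z)=1+(x+y)zM(z)+\alpha z^2M^2(z)$ (generating function of two-coloured Motzkin paths from $(0,0)$ ending on the $x$-axis). $\langle z^n\rangle$ denotes coefficient extraction; $n,f$ are positive integers and $t$ a non-negative integer (the lemma is applied with $t<f$). Any expression containing $m!$ with $m<0$ in the denominator is interpreted as $0$. -}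

module Defs where

open import Data.Nat as N using (ℕ; zero; suc; _∸_; _!)
open import Data.Nat.Properties using (_!≢0)
open import Data.Integer as Zi using (ℤ; +_; -[1+_])
open import Data.Rational as Q using (ℚ; 0ℚ; 1ℚ)
open import Relation.Binary.PropositionalEquality using (_≡_)
open import Relation.Nullary using (yes; no)

-- Poly : coefficients of x^a y^b α^c  (an element of ℚ[[x,y,α]], which
--        contains the polynomial ring ℚ[x,y,α] as a subring)
-- Ser  : power series in z with coefficients in Poly; F n is ⟨z^n⟩ F.

Poly : Set
Poly = ℕ → ℕ → ℕ → ℚ

Ser : Set
Ser = ℕ → Poly

⟨z^_⟩ : ℕ → Ser → Poly
⟨z^ n ⟩ F = F n

sumTo : ℕ → (ℕ → ℚ) → ℚ
sumTo zero    g = g zero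
sumTo (suc n) g = sumTo n g Q.+ g (suc n)

infix 4 _≈_
_≈_ : Ser → Ser → Set
F ≈ G = ∀ n a b c → F n a b c ≡ G n a b c

infixl 6 _⊕_ _⊖_
infixl 7 _⊗_
infixr 8 _^_

_⊕_ : Ser → Ser → Ser
(F ⊕ G) n a b c = F n a b c Q.+ G n a b c

_⊖_ : Ser → Ser → Ser
(F ⊖ G) n a b c = F n a b c Q.- G n a b c

_⊗_ : Ser → Ser → Ser
(F ⊗ G) n a b c =
  sumTo n λ i → sumTo a λ j → sumTo b λ k → sumTo c λ l →
    F i j k l Q.* G (n ∸ i) (a ∸ j) (b ∸ k) (c ∸ l)

mono : ℕ → ℕ → ℕ → ℕ → Ser
mono n a b c n' a' b' c' with n N.≟ n' | a N.≟ a' | b N.≟ b' | c N.≟ c'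
... | yes _ | yes _ | yes _ | yes _ = 1ℚ
... | _     | _     | _     | _     = 0ℚ

𝟙 Zs Xs Ys As : Ser
𝟙  = mono 0 0 0 0
Zs = mono 1 0 0 0
Xs = mono 0 1 0 0
Ys = mono 0 0 1 0
As = mono 0 0 0 1

_^_ : Ser → ℕ → Ser
F ^ zero  = 𝟙
F ^ suc k = F ⊗ (F ^ k)

-- m! for an integer m (only ever used with m ≥ 0 in a non-vanishing term;
-- the value 0 for m < 0 is an irrelevant convention)
fct : ℤ → ℚ
fct (+ m)    = + (m !) Q./ 1
fct -[1+ _ ] = 0ℚ

-- 1/m! with the paper's convention: 1/m! = 0 when m < 0
invFct : ℤ → ℚ
invFct (+ m)    = (+ 1 Q./ (m !)) {{m !≢0}}
invFct -[1+ _ ] = 0ℚ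

-- 1/m for an integer m (value at m = 0 is an irrelevant convention: it
-- only occurs in terms already killed by 1/(e-f-1)! = 0)
recip : ℤ → ℚ
recip (+ zero)   = 0ℚ
recip (+ suc k)  = + 1 Q./ suc k
recip -[1+ k ]   = -[1+ 0 ] Q./ suc k

ι : ℕ → ℤ
ι = +_

rhsTerm : (n f t c d e : ℕ) → ℚ
rhsTerm n f t c d e =
  let open Zi using (_+_; _-_; _*_) in
  (fct (ι n - ι 1) Q.* fct (ι n - ι d - ι f - ι 1)
     Q.* recip (ι c + ι e - ι f) Q.* invFct (ι c) Q.* invFct (ι d)
     Q.* invFct (ι n - ι d - ι 1) Q.* invFct (ι e - ι f + ι t - ι 1)
     Q.* invFct (ι e - ι f - ι 1))
  Q.-
  (fct (ι n - ι 1) Q.* fct (ι n - ι d - ι f + ι t - ι 1)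
     Q.* recip (ι c + ι e - ι f) Q.* invFct (ι c) Q.* invFct (ι d)
     Q.* invFct (ι n - ι d - ι 1) Q.* invFct (ι e - ι f + ι 2 * ι t - ι 1)
     Q.* invFct (ι e - ι f - ι 1))

rhs : (n f t : ℕ) → Poly
rhs n f t c d e with Zi._≟_ (Zi._+_ (ι (c N.+ d N.+ 2 N.* e)) (Zi._-_ (ι t) (ι f))) (ι n)
... | yes _ = rhsTerm n f t c d e
... | no  _ = 0ℚ

{-# OPTIONS --safe #-}

-- Write a = zW, b = zM and D = x + αzM. The equations for M and W give M = W (1 + zMD), hence
-- abD = b - a, so Q₀ = -Σ_{j<t} b^(j+1) a^(t-j) satisfies Q₀ D = aᵗ - bᵗ; it is the only such
-- series because x + zF is never a zero divisor. The left-hand side therefore equals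
-- -Σ_{j<t} z^(f+t+2) α^(f+1) W^(f-j) M^(t+j+2) V. The series W^k M^(L+1) V satisfy recurrences,
-- inherited from W = 1 + yzW, M = 1 + (x+y)zM + αz²M² and V = 1 + αz²M²V, which determine them;
-- an explicit multinomial formula satisfies the same recurrences, so the coefficient of
-- z^(a+b+2c) x^a y^b α^c in W^k M^(L+1) V is C(a+b+2c+L+k, b) (a+2c+L)! / (a! c! (c+L)!).
-- Summed over j these trinomial coefficients telescope to the difference of the two terms
-- on the right-hand side.

module Submission where

open import Algebra.Bundles using (CommutativeRing; CommutativeSemiring)
import Algebra.Properties.Semiring.Exp
import Defs

module FiniteSums {c ℓ} (R : CommutativeSemiring c ℓ) where

  open import Data.Nat using (ℕ; zero; suc; _∸_; _≤_; _<_; z≤n; s≤s; _≟_)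
  open import Data.Nat.Properties
    using (m≤n⇒m≤1+n; m<n⇒m<1+n; ≤-refl; <⇒≢; ≤∧≢⇒<; ≤-pred; +-∸-assoc; n∸n≡0)
  open import Relation.Binary.PropositionalEquality as ≡ using (_≡_; _≢_)
  open import Relation.Nullary using (yes; no)
  open CommutativeSemiring R hiding (zero)
  open import Algebra.Properties.CommutativeSemigroup +-commutativeSemigroup using (interchange)
  open import Relation.Binary.Reasoning.Setoid setoid

  sumTo : ℕ → (ℕ → Carrier) → Carrier
  sumTo zero    g = g zero
  sumTo (suc n) g = sumTo n g + g (suc n)

  sumTo-cong : ∀ n {f g : ℕ → Carrier} → (∀ i → i ≤ n → f i ≈ g i) → sumTo n f ≈ sumTo n g
  sumTo-cong zero    f≈g = f≈g zero z≤n
  sumTo-cong (suc n) f≈g = +-cong (sumTo-cong n (λ i i≤n → f≈g i (m≤n⇒m≤1+n i≤n))) (f≈g (suc n) ≤-refl)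

  sumTo-+ : ∀ n (f g : ℕ → Carrier) → sumTo n (λ i → f i + g i) ≈ sumTo n f + sumTo n g
  sumTo-+ zero    f g = refl
  sumTo-+ (suc n) f g = trans (+-congʳ (sumTo-+ n f g)) (interchange _ _ _ _)

  *-distribˡ-sumTo : ∀ n x (g : ℕ → Carrier) → x * sumTo n g ≈ sumTo n (λ i → x * g i)
  *-distribˡ-sumTo zero    x g = refl
  *-distribˡ-sumTo (suc n) x g = trans (distribˡ _ _ _) (+-congʳ (*-distribˡ-sumTo n x g))

  *-distribʳ-sumTo : ∀ n x (g : ℕ → Carrier) → sumTo n g * x ≈ sumTo n (λ i → g i * x)
  *-distribʳ-sumTo zero    x g = refl
  *-distribʳ-sumTo (suc n) x g = trans (distribʳ _ _ _) (+-congʳ (*-distribʳ-sumTo n x g))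

  sumTo-zero : ∀ n {g : ℕ → Carrier} → (∀ i → i ≤ n → g i ≈ 0#) → sumTo n g ≈ 0#
  sumTo-zero zero    g≈0 = g≈0 zero z≤n
  sumTo-zero (suc n) g≈0 =
    trans (+-cong (sumTo-zero n (λ i i≤n → g≈0 i (m≤n⇒m≤1+n i≤n))) (g≈0 (suc n) ≤-refl)) (+-identityˡ 0#)

  sumTo-suc : ∀ n (g : ℕ → Carrier) → sumTo (suc n) g ≈ g zero + sumTo n (λ i → g (suc i))
  sumTo-suc zero    g = refl
  sumTo-suc (suc n) g = trans (+-congʳ (sumTo-suc n g)) (+-assoc _ _ _)

  sumTo-reverse : ∀ n (g : ℕ → Carrier) → sumTo n g ≈ sumTo n (λ i → g (n ∸ i))
  sumTo-reverse zero    g = refl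
  sumTo-reverse (suc n) g = begin
    sumTo n g + g (suc n)                       ≈⟨ +-comm _ _ ⟩
    g (suc n) + sumTo n g                       ≈⟨ +-congˡ (sumTo-reverse n g) ⟩
    g (suc n) + sumTo n (λ i → g (n ∸ i))       ≈⟨ sumTo-suc n (λ i → g (suc n ∸ i)) ⟨
    sumTo (suc n) (λ i → g (suc n ∸ i))         ∎

  sumTo-single : ∀ n p {g : ℕ → Carrier} → p ≤ n → (∀ i → i ≤ n → i ≢ p → g i ≈ 0#) → sumTo n g ≈ g p
  sumTo-single zero    zero    z≤n g≈0 = refl
  sumTo-single (suc n) p {g} p≤1+n g≈0 with p ≟ suc n
  ... | yes ≡.refl = trans (+-congʳ (sumTo-zero n (λ i i≤n → g≈0 i (m≤n⇒m≤1+n i≤n) (<⇒≢ (s≤s i≤n)))))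
                           (+-identityˡ _)
  ... | no  p≢1+n  = trans (+-congˡ (g≈0 (suc n) ≤-refl (λ 1+n≡p → p≢1+n (≡.sym 1+n≡p))))
                     (trans (+-identityʳ _)
                       (sumTo-single n p (≤-pred (≤∧≢⇒< p≤1+n p≢1+n)) (λ i i≤n → g≈0 i (m≤n⇒m≤1+n i≤n))))

  sumTo-triangle : ∀ n (F : ℕ → ℕ → Carrier) →
    sumTo n (λ i → sumTo (n ∸ i) (F i)) ≈ sumTo n (λ k → sumTo k (λ i → F i (k ∸ i)))
  sumTo-triangle zero    F = refl
  sumTo-triangle (suc n) F = begin
    sumTo n (λ i → sumTo (suc n ∸ i) (F i)) + sumTo (n ∸ n) (F (suc n))
      ≈⟨ +-cong (sumTo-cong n (λ i i≤n → reflexive (≡.cong (λ m → sumTo m (F i)) (+-∸-assoc 1 i≤n))))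
                (reflexive (≡.cong (λ m → sumTo m (F (suc n))) (n∸n≡0 n))) ⟩
    sumTo n (λ i → sumTo (n ∸ i) (F i) + F i (suc (n ∸ i))) + F (suc n) 0
      ≈⟨ +-congʳ (sumTo-+ n _ _) ⟩
    (sumTo n (λ i → sumTo (n ∸ i) (F i)) + sumTo n (λ i → F i (suc (n ∸ i)))) + F (suc n) 0
      ≈⟨ +-assoc _ _ _ ⟩
    sumTo n (λ i → sumTo (n ∸ i) (F i)) + (sumTo n (λ i → F i (suc (n ∸ i))) + F (suc n) 0)
      ≈⟨ +-cong (sumTo-triangle n F)
                (+-cong (sumTo-cong n (λ i i≤n → reflexive (≡.cong (F i) (≡.sym (+-∸-assoc 1 i≤n)))))
                        (reflexive (≡.cong (F (suc n)) (≡.sym (n∸n≡0 (suc n)))))) ⟩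
    sumTo n (λ k → sumTo k (λ i → F i (k ∸ i))) + sumTo (suc n) (λ i → F i (suc n ∸ i)) ∎

  sumBelow : ℕ → (ℕ → Carrier) → Carrier
  sumBelow zero    g = 0#
  sumBelow (suc t) g = sumBelow t g + g t

  sumBelow-cong : ∀ t {f g : ℕ → Carrier} → (∀ j → j < t → f j ≈ g j) → sumBelow t f ≈ sumBelow t g
  sumBelow-cong zero    f≈g = refl
  sumBelow-cong (suc t) f≈g = +-cong (sumBelow-cong t (λ j j<t → f≈g j (m<n⇒m<1+n j<t))) (f≈g t ≤-refl)

  *-distribˡ-sumBelow : ∀ t x (g : ℕ → Carrier) → x * sumBelow t g ≈ sumBelow t (λ j → x * g j)
  *-distribˡ-sumBelow zero    x g = zeroʳ x
  *-distribˡ-sumBelow (suc t) x g = trans (distribˡ x _ _) (+-congʳ (*-distribˡ-sumBelow t x g))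

  *-distribʳ-sumBelow : ∀ t x (g : ℕ → Carrier) → sumBelow t g * x ≈ sumBelow t (λ j → g j * x)
  *-distribʳ-sumBelow zero    x g = zeroˡ x
  *-distribʳ-sumBelow (suc t) x g = trans (distribʳ x _ _) (+-congʳ (*-distribʳ-sumBelow t x g))

  sumBelow-zero : ∀ t {g : ℕ → Carrier} → (∀ j → j < t → g j ≈ 0#) → sumBelow t g ≈ 0#
  sumBelow-zero t {g} g≈0 = trans (sumBelow-cong t g≈0) (zero-sum t)
    where
    zero-sum : ∀ t → sumBelow t (λ _ → 0#) ≈ 0#
    zero-sum zero    = refl
    zero-sum (suc t) = trans (+-identityʳ _) (zero-sum t)

module PowerSeries {c ℓ} (R : CommutativeRing c ℓ) where

  import Algebra.Construct.Pointwise as Pointwise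
  open import Algebra.Structures using (IsCommutativeRing)
  open import Data.Nat using (ℕ; zero; suc; _∸_; _≤_; z≤n)
  open import Data.Nat.Properties using (∸-+-assoc; m+[n∸m]≡n; m∸[m∸n]≡n)
  open import Data.Product using (_,_)
  open import Relation.Binary.PropositionalEquality as ≡ using (_≡_)
  open import Relation.Nullary using (contradiction)
  open CommutativeRing R hiding (zero; isCommutativeRing)
  open FiniteSums commutativeSemiring
  open import Relation.Binary.Reasoning.Setoid setoid

  Series : Set c
  Series = ℕ → Carrier

  infix  4 _≈ₛ_
  infixl 6 _+ₛ_
  infixl 7 _*ₛ_

  _≈ₛ_ : Series → Series → Set ℓ
  f ≈ₛ g = ∀ n → f n ≈ g n

  _+ₛ_ _*ₛ_ : Series → Series → Series
  (f +ₛ g) n = f n + g n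
  (f *ₛ g) n = sumTo n (λ i → f i * g (n ∸ i))

  -ₛ_ : Series → Series
  (-ₛ f) n = - f n

  0ₛ 1ₛ : Series
  0ₛ _       = 0#
  1ₛ zero    = 1#
  1ₛ (suc _) = 0#

  *ₛ-comm : ∀ f g → f *ₛ g ≈ₛ g *ₛ f
  *ₛ-comm f g n = trans (sumTo-reverse n _) (sumTo-cong n (λ i i≤n →
    trans (*-comm _ _) (*-congʳ (reflexive (≡.cong g (m∸[m∸n]≡n i≤n))))))

  *ₛ-cong : ∀ {f f′ g g′} → f ≈ₛ f′ → g ≈ₛ g′ → f *ₛ g ≈ₛ f′ *ₛ g′
  *ₛ-cong f≈f′ g≈g′ n = sumTo-cong n (λ i _ → *-cong (f≈f′ i) (g≈g′ (n ∸ i)))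

  *ₛ-identityˡ : ∀ f → 1ₛ *ₛ f ≈ₛ f
  *ₛ-identityˡ f n = trans (sumTo-single n 0 z≤n λ { zero _ 0≢0 → contradiction ≡.refl 0≢0
                                                    ; (suc i) _ _ → zeroˡ _ })
                           (*-identityˡ _)

  *ₛ-identityʳ : ∀ f → f *ₛ 1ₛ ≈ₛ f
  *ₛ-identityʳ f n = trans (*ₛ-comm f 1ₛ n) (*ₛ-identityˡ f n)

  *ₛ-distribˡ : ∀ f g h → f *ₛ (g +ₛ h) ≈ₛ f *ₛ g +ₛ f *ₛ h
  *ₛ-distribˡ f g h n = trans (sumTo-cong n (λ i _ → distribˡ _ _ _)) (sumTo-+ n _ _)

  *ₛ-distribʳ : ∀ h f g → (f +ₛ g) *ₛ h ≈ₛ f *ₛ h +ₛ g *ₛ h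
  *ₛ-distribʳ h f g n = trans (sumTo-cong n (λ i _ → distribʳ _ _ _)) (sumTo-+ n _ _)

  *ₛ-assoc : ∀ f g h → (f *ₛ g) *ₛ h ≈ₛ f *ₛ (g *ₛ h)
  *ₛ-assoc f g h n = sym (begin
    sumTo n (λ i → f i * sumTo (n ∸ i) (λ j → g j * h (n ∸ i ∸ j)))
      ≈⟨ sumTo-cong n (λ i _ → *-distribˡ-sumTo (n ∸ i) (f i) _) ⟩
    sumTo n (λ i → sumTo (n ∸ i) (λ j → f i * (g j * h (n ∸ i ∸ j))))
      ≈⟨ sumTo-triangle n (λ i j → f i * (g j * h (n ∸ i ∸ j))) ⟩
    sumTo n (λ k → sumTo k (λ i → f i * (g (k ∸ i) * h (n ∸ i ∸ (k ∸ i)))))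
      ≈⟨ sumTo-cong n (λ k _ → sumTo-cong k (λ i i≤k →
           trans (sym (*-assoc _ _ _)) (*-congˡ (reflexive (≡.cong h (n∸i∸[k∸i]≡n∸k n i≤k)))))) ⟩
    sumTo n (λ k → sumTo k (λ i → (f i * g (k ∸ i)) * h (n ∸ k)))
      ≈⟨ sumTo-cong n (λ k _ → sym (*-distribʳ-sumTo k (h (n ∸ k)) _)) ⟩
    sumTo n (λ k → sumTo k (λ i → f i * g (k ∸ i)) * h (n ∸ k)) ∎)
    where
    n∸i∸[k∸i]≡n∸k : ∀ {i k} n → i ≤ k → n ∸ i ∸ (k ∸ i) ≡ n ∸ k
    n∸i∸[k∸i]≡n∸k {i} {k} n i≤k = ≡.trans (∸-+-assoc n i (k ∸ i)) (≡.cong (n ∸_) (m+[n∸m]≡n i≤k))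

  isCommutativeRingₛ : IsCommutativeRing _≈ₛ_ _+ₛ_ _*ₛ_ -ₛ_ 0ₛ 1ₛ
  isCommutativeRingₛ = record
    { isRing = record
      { +-isAbelianGroup = Pointwise.isAbelianGroup ℕ +-isAbelianGroup
      ; *-cong           = *ₛ-cong
      ; *-assoc          = *ₛ-assoc
      ; *-identity       = *ₛ-identityˡ , *ₛ-identityʳ
      ; distrib          = *ₛ-distribˡ , *ₛ-distribʳ
      }
    ; *-comm = *ₛ-comm
    }

  seriesRing : CommutativeRing c ℓ
  seriesRing = record { isCommutativeRing = isCommutativeRingₛ }

  sumTo-coefficient : ∀ n (g : ℕ → Series) k →
    FiniteSums.sumTo (CommutativeRing.commutativeSemiring seriesRing) n g k ≈ sumTo n (λ i → g i k)
  sumTo-coefficient zero    g k = refl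
  sumTo-coefficient (suc n) g k = +-congʳ (sumTo-coefficient n g k)

-- The library's ring solvers take coefficients from ℕ or from the ring itself; integer coefficients
-- let solve prove identities involving subtraction in rings whose equality is not decidable.
module IntegerCoefficientSolver {c ℓ} (R : CommutativeRing c ℓ) where

  open import Data.Integer as ℤ using (ℤ; +_; -[1+_]; _⊖_; sign; ∣_∣; _◃_)
  import Data.Integer.Properties as ℤ
  open import Data.Maybe using (Maybe; just; nothing)
  open import Data.Nat as ℕ using (ℕ)
  open import Data.Sign as Sign using (Sign)
  open import Relation.Binary.PropositionalEquality as ≡ using ()
  open import Relation.Nullary using (yes; no)
  open import Algebra.Solver.Ring.AlmostCommutativeRing
    using (AlmostCommutativeRing; fromCommutativeRing; _-Raw-AlmostCommutative⟶_)
  open CommutativeRing R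
  open import Algebra.Properties.Ring ring using (-‿+-comm; -0#≈0#; -‿involutive; -1*x≈-x)
  open import Algebra.Properties.Semiring.Mult.TCOptimised semiring using (_×_; 1+×; ×-homo-+; ×1-homo-*)
  open import Algebra.Properties.CommutativeSemigroup +-commutativeSemigroup using (interchange)
  open import Algebra.Properties.CommutativeSemigroup *-commutativeSemigroup
    using () renaming (interchange to *-interchange)
  open import Relation.Binary.Reasoning.Setoid setoid

  ⟦_⟧ℤ : ℤ → Carrier
  ⟦ + n      ⟧ℤ = n × 1#
  ⟦ -[1+ n ] ⟧ℤ = - (ℕ.suc n × 1#)

  ⊖-homo : ∀ m n → ⟦ m ⊖ n ⟧ℤ ≈ m × 1# - n × 1#
  ⊖-homo m            ℕ.zero       = sym (trans (+-congˡ -0#≈0#) (+-identityʳ _))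
  ⊖-homo ℕ.zero       (ℕ.suc n)    = sym (+-identityˡ _)
  ⊖-homo (ℕ.suc m) (ℕ.suc n) = begin
    ⟦ ℕ.suc m ⊖ ℕ.suc n ⟧ℤ             ≈⟨ reflexive (≡.cong ⟦_⟧ℤ (ℤ.[1+m]⊖[1+n]≡m⊖n m n)) ⟩
    ⟦ m ⊖ n ⟧ℤ                         ≈⟨ ⊖-homo m n ⟩
    m × 1# - n × 1#                    ≈⟨ +-identityˡ _ ⟨
    0# + (m × 1# - n × 1#)             ≈⟨ +-congʳ (-‿inverseʳ 1#) ⟨
    (1# - 1#) + (m × 1# - n × 1#)      ≈⟨ interchange _ _ _ _ ⟩
    (1# + m × 1#) + (- 1# - n × 1#)    ≈⟨ +-cong (1+× m 1#) (trans (-‿cong (1+× n 1#)) (sym (-‿+-comm 1# (n × 1#)))) ⟨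
    ℕ.suc m × 1# - ℕ.suc n × 1#        ∎

  +-homo : ∀ i j → ⟦ i ℤ.+ j ⟧ℤ ≈ ⟦ i ⟧ℤ + ⟦ j ⟧ℤ
  +-homo -[1+ m ] -[1+ n ] = begin
    - (ℕ.suc (ℕ.suc (m ℕ.+ n)) × 1#)
      ≈⟨ -‿cong (reflexive (≡.cong (λ k → ℕ.suc k × 1#) (≡.sym (ℕ+-suc m n)))) ⟩
    - ((ℕ.suc m ℕ.+ ℕ.suc n) × 1#)        ≈⟨ -‿cong (×-homo-+ 1# (ℕ.suc m) (ℕ.suc n)) ⟩
    - (ℕ.suc m × 1# + ℕ.suc n × 1#)       ≈⟨ -‿+-comm _ _ ⟨
    - (ℕ.suc m × 1#) - ℕ.suc n × 1#       ∎
    where open import Data.Nat.Properties using () renaming (+-suc to ℕ+-suc)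
  +-homo -[1+ m ] (+ n)    = trans (⊖-homo n (ℕ.suc m)) (+-comm _ _)
  +-homo (+ m)    -[1+ n ] = ⊖-homo m (ℕ.suc n)
  +-homo (+ m)    (+ n)    = ×-homo-+ 1# m n

  ⟦_⟧± : Sign → Carrier
  ⟦ Sign.+ ⟧± = 1#
  ⟦ Sign.- ⟧± = - 1#

  ◃-homo : ∀ s n → ⟦ s ◃ n ⟧ℤ ≈ ⟦ s ⟧± * n × 1#
  ◃-homo s        ℕ.zero    = sym (zeroʳ _)
  ◃-homo Sign.+ (ℕ.suc n) = sym (*-identityˡ _)
  ◃-homo Sign.- (ℕ.suc n) = sym (-1*x≈-x _)

  sign-abs-homo : ∀ i → ⟦ i ⟧ℤ ≈ ⟦ sign i ⟧± * ∣ i ∣ × 1#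
  sign-abs-homo i = trans (reflexive (≡.cong ⟦_⟧ℤ (≡.sym (ℤ.◃-inverse i)))) (◃-homo (sign i) ∣ i ∣)

  sign-*-homo : ∀ s t → ⟦ s Sign.* t ⟧± ≈ ⟦ s ⟧± * ⟦ t ⟧±
  sign-*-homo Sign.+ t      = sym (*-identityˡ _)
  sign-*-homo Sign.- Sign.+ = sym (*-identityʳ _)
  sign-*-homo Sign.- Sign.- = begin
    1#               ≈⟨ -‿involutive 1# ⟨
    - (- 1#)         ≈⟨ -1*x≈-x (- 1#) ⟨
    - 1# * - 1#      ∎

  *-homo : ∀ i j → ⟦ i ℤ.* j ⟧ℤ ≈ ⟦ i ⟧ℤ * ⟦ j ⟧ℤ
  *-homo i j = begin
    ⟦ (sign i Sign.* sign j) ◃ (∣ i ∣ ℕ.* ∣ j ∣) ⟧ℤ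
      ≈⟨ ◃-homo (sign i Sign.* sign j) (∣ i ∣ ℕ.* ∣ j ∣) ⟩
    ⟦ sign i Sign.* sign j ⟧± * (∣ i ∣ ℕ.* ∣ j ∣) × 1#
      ≈⟨ *-cong (sign-*-homo (sign i) (sign j)) (×1-homo-* ∣ i ∣ ∣ j ∣) ⟩
    (⟦ sign i ⟧± * ⟦ sign j ⟧±) * (∣ i ∣ × 1# * ∣ j ∣ × 1#)
      ≈⟨ *-interchange _ _ _ _ ⟩
    (⟦ sign i ⟧± * ∣ i ∣ × 1#) * (⟦ sign j ⟧± * ∣ j ∣ × 1#)
      ≈⟨ *-cong (sign-abs-homo i) (sign-abs-homo j) ⟨
    ⟦ i ⟧ℤ * ⟦ j ⟧ℤ ∎

  -‿homo : ∀ i → ⟦ ℤ.- i ⟧ℤ ≈ - ⟦ i ⟧ℤ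
  -‿homo (+ ℕ.zero)  = sym -0#≈0#
  -‿homo (+ ℕ.suc n) = refl
  -‿homo -[1+ n ]    = sym (-‿involutive _)

  almostCommutativeRing : AlmostCommutativeRing c ℓ
  almostCommutativeRing = fromCommutativeRing R

  ℤ-morphism : ℤ.+-*-rawRing -Raw-AlmostCommutative⟶ almostCommutativeRing
  ℤ-morphism = record
    { ⟦_⟧ = ⟦_⟧ℤ ; +-homo = +-homo ; *-homo = *-homo ; -‿homo = -‿homo ; 0-homo = refl ; 1-homo = refl }

  _≟ℤ_ : ∀ i j → Maybe (⟦ i ⟧ℤ ≈ ⟦ j ⟧ℤ)
  i ≟ℤ j with i ℤ.≟ j
  ... | yes ≡.refl = just refl
  ... | no  _      = nothing

  open import Algebra.Solver.Ring ℤ.+-*-rawRing almostCommutativeRing ℤ-morphism _≟ℤ_ public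

module GeometricSums {c ℓ} (R : CommutativeRing c ℓ) where

  open import Data.Nat using (ℕ; zero; suc; _∸_)
  open import Data.Nat.Properties using (+-∸-assoc; <⇒≤; m+n∸n≡m)
  open CommutativeRing R
  open FiniteSums commutativeSemiring
  open import Algebra.Properties.Semiring.Exp semiring using (_^_; ^-congʳ)
  open IntegerCoefficientSolver R using (solve; _:+_; _:*_; :-_; _:=_)
  open import Relation.Binary.Reasoning.Setoid setoid

  geometric : Carrier → Carrier → ℕ → Carrier
  geometric a b t = sumBelow t (λ j → b ^ suc j * a ^ (t ∸ j))

  geometric-suc : ∀ a b t → geometric a b (suc t) ≈ a * geometric a b t + b ^ suc t * a
  geometric-suc a b t = begin
    sumBelow t (λ j → b ^ suc j * a ^ (suc t ∸ j)) + b ^ suc t * a ^ (suc t ∸ t)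
      ≈⟨ +-cong (sumBelow-cong t (λ j j<t → *-congˡ (^-congʳ a (+-∸-assoc 1 (<⇒≤ j<t)))))
                (*-congˡ (^-congʳ a (m+n∸n≡m 1 t))) ⟩
    sumBelow t (λ j → b ^ suc j * (a * a ^ (t ∸ j))) + b ^ suc t * (a * 1#)
      ≈⟨ +-cong (sumBelow-cong t (λ j _ → x*[y*z]≈y*[x*z] _ _ _)) (*-congˡ (*-identityʳ a)) ⟩
    sumBelow t (λ j → a * (b ^ suc j * a ^ (t ∸ j))) + b ^ suc t * a
      ≈⟨ +-congʳ (*-distribˡ-sumBelow t a _) ⟨
    a * geometric a b t + b ^ suc t * a ∎
    where
    x*[y*z]≈y*[x*z] : ∀ x y z → x * (y * z) ≈ y * (x * z)
    x*[y*z]≈y*[x*z] = solve 3 (λ x y z → x :* (y :* z) := y :* (x :* z)) refl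

  *-geometric : ∀ a b d → a * b * d ≈ b - a → ∀ t → d * geometric a b t ≈ b ^ t - a ^ t
  *-geometric a b d abd≈b-a zero = trans (zeroʳ d) (sym (-‿inverseʳ 1#))
  *-geometric a b d abd≈b-a (suc t) = begin
    d * geometric a b (suc t)                   ≈⟨ *-congˡ (geometric-suc a b t) ⟩
    d * (a * geometric a b t + b ^ suc t * a)   ≈⟨ regroup d a (geometric a b t) b (b ^ t) ⟩
    a * (d * geometric a b t) + b ^ t * (a * b * d) ≈⟨ +-cong (*-congˡ (*-geometric a b d abd≈b-a t)) (*-congˡ abd≈b-a) ⟩
    a * (b ^ t - a ^ t) + b ^ t * (b - a)       ≈⟨ telescope a (a ^ t) b (b ^ t) ⟩
    b ^ suc t - a ^ suc t                       ∎
    where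
    regroup : ∀ d a s b B → d * (a * s + (b * B) * a) ≈ a * (d * s) + B * (a * b * d)
    regroup = solve 5 (λ d a s b B → d :* (a :* s :+ (b :* B) :* a) := a :* (d :* s) :+ B :* (a :* b :* d)) refl
    telescope : ∀ a A b B → a * (B - A) + B * (b - a) ≈ b * B - a * A
    telescope = solve 4 (λ a A b B → a :* (B :+ :- A) :+ B :* (b :+ :- a) := b :* B :+ :- (a :* A)) refl

module SeriesRing where

  open import Defs
  open import Algebra.Bundles using (CommutativeRing)
  open import Algebra.Structures using (IsCommutativeRing)
  open import Data.Nat using (ℕ; zero; suc; _∸_; _≤_)
  open import Data.Rational as ℚ using (ℚ; 0ℚ)
  import Data.Rational.Properties as ℚ
  open import Level using (0ℓ)
  open import Relation.Binary.PropositionalEquality using (_≡_; _≢_; refl; cong; trans; sym)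

  -- Ser is ℚ[[α]][[y]][[x]][[z]]: the product of this iterated power series ring is the
  -- Cauchy product ⊗ in all four variables, which therefore inherits the ring laws.
  ℚ-ring αRing yαRing xyαRing zxyαRing : CommutativeRing 0ℓ 0ℓ
  ℚ-ring    = ℚ.+-*-commutativeRing
  αRing     = PowerSeries.seriesRing ℚ-ring
  yαRing    = PowerSeries.seriesRing αRing
  xyαRing   = PowerSeries.seriesRing yαRing
  zxyαRing  = PowerSeries.seriesRing xyαRing

  private
    module ℚΣ  = FiniteSums (CommutativeRing.commutativeSemiring ℚ-ring)
    module α   = CommutativeRing αRing
    module yα  = CommutativeRing yαRing
    module xyα = CommutativeRing xyαRing
    module zxyα = CommutativeRing zxyαRing

  sumTo≡ℚ-sumTo : ∀ n g → sumTo n g ≡ ℚΣ.sumTo n g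
  sumTo≡ℚ-sumTo zero    g = refl
  sumTo≡ℚ-sumTo (suc n) g = cong (ℚ._+ g (suc n)) (sumTo≡ℚ-sumTo n g)

  sumTo-zero : ∀ n {g : ℕ → ℚ} → (∀ i → i ≤ n → g i ≡ 0ℚ) → sumTo n g ≡ 0ℚ
  sumTo-zero n g≡0 = trans (sumTo≡ℚ-sumTo n _) (ℚΣ.sumTo-zero n g≡0)

  sumTo-single : ∀ n p {g : ℕ → ℚ} → p ≤ n → (∀ i → i ≤ n → i ≢ p → g i ≡ 0ℚ) → sumTo n g ≡ g p
  sumTo-single n p p≤n g≡0 = trans (sumTo≡ℚ-sumTo n _) (ℚΣ.sumTo-single n p p≤n g≡0)

  α-* : ∀ f g c → (f α.* g) c ≡ sumTo c (λ l → f l ℚ.* g (c ∸ l))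
  α-* f g c = sym (sumTo≡ℚ-sumTo c _)

  yα-* : ∀ f g b c → (f yα.* g) b c ≡ sumTo b (λ k → sumTo c (λ l → f k l ℚ.* g (b ∸ k) (c ∸ l)))
  yα-* f g b c = trans (PowerSeries.sumTo-coefficient ℚ-ring b _ c)
    (trans (ℚΣ.sumTo-cong b (λ k _ → α-* (f k) (g (b ∸ k)) c)) (sym (sumTo≡ℚ-sumTo b _)))

  xyα-* : ∀ f g a b c → (f xyα.* g) a b c ≡
    sumTo a (λ j → sumTo b (λ k → sumTo c (λ l → f j k l ℚ.* g (a ∸ j) (b ∸ k) (c ∸ l))))
  xyα-* f g a b c = trans (PowerSeries.sumTo-coefficient αRing a _ b c) (trans (PowerSeries.sumTo-coefficient ℚ-ring a _ c)
    (trans (ℚΣ.sumTo-cong a (λ j _ → yα-* (f j) (g (a ∸ j)) b c)) (sym (sumTo≡ℚ-sumTo a _))))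

  zxyα-*≈⊗ : ∀ F G → F zxyα.* G ≈ F ⊗ G
  zxyα-*≈⊗ F G n a b c =
    trans (PowerSeries.sumTo-coefficient yαRing n _ a b c) (trans (PowerSeries.sumTo-coefficient αRing n _ b c)
      (trans (PowerSeries.sumTo-coefficient ℚ-ring n _ c)
        (trans (ℚΣ.sumTo-cong n (λ i _ → xyα-* (F i) (G (n ∸ i)) a b c)) (sym (sumTo≡ℚ-sumTo n _)))))

  𝟙≈1 : 𝟙 ≈ zxyα.1#
  𝟙≈1 zero    zero    zero    zero    = refl
  𝟙≈1 zero    zero    zero    (suc c) = refl
  𝟙≈1 zero    zero    (suc b) c       = refl
  𝟙≈1 zero    (suc a) b       c       = refl
  𝟙≈1 (suc n) a       b       c       = refl

  private
    ⊗≈* : ∀ F G → F ⊗ G ≈ F zxyα.* G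
    ⊗≈* F G = zxyα.sym (zxyα-*≈⊗ F G)

  ⊗-cong : ∀ {F F′ G G′} → F ≈ F′ → G ≈ G′ → F ⊗ G ≈ F′ ⊗ G′
  ⊗-cong {F} {F′} {G} {G′} F≈F′ G≈G′ =
    zxyα.trans (⊗≈* F G) (zxyα.trans (zxyα.*-cong {F} {F′} {G} {G′} F≈F′ G≈G′) (zxyα-*≈⊗ F′ G′))

  ⊗-assoc : ∀ F G H → (F ⊗ G) ⊗ H ≈ F ⊗ (G ⊗ H)
  ⊗-assoc F G H = zxyα.trans (⊗≈* (F ⊗ G) H) (zxyα.trans (zxyα.*-congʳ {H} {F ⊗ G} (⊗≈* F G))
    (zxyα.trans (zxyα.*-assoc F G H) (zxyα.trans (zxyα.*-congˡ {F} (zxyα-*≈⊗ G H)) (zxyα-*≈⊗ F (G ⊗ H)))))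

  ⊗-comm : ∀ F G → F ⊗ G ≈ G ⊗ F
  ⊗-comm F G = zxyα.trans (⊗≈* F G) (zxyα.trans (zxyα.*-comm F G) (zxyα-*≈⊗ G F))

  ⊗-identityˡ : ∀ F → 𝟙 ⊗ F ≈ F
  ⊗-identityˡ F = zxyα.trans (⊗≈* 𝟙 F) (zxyα.trans (zxyα.*-congʳ {F} {𝟙} 𝟙≈1) (zxyα.*-identityˡ F))

  ⊗-distribʳ : ∀ H F G → (F ⊕ G) ⊗ H ≈ F ⊗ H ⊕ G ⊗ H
  ⊗-distribʳ H F G = zxyα.trans (⊗≈* (F ⊕ G) H)
    (zxyα.trans (zxyα.distribʳ H F G) (zxyα.+-cong (zxyα-*≈⊗ F H) (zxyα-*≈⊗ G H)))

  ⊗-isCommutativeRing : IsCommutativeRing _≈_ _⊕_ _⊗_ zxyα.-_ zxyα.0# 𝟙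
  ⊗-isCommutativeRing = record
    { isRing = record
      { +-isAbelianGroup = zxyα.+-isAbelianGroup
      ; *-cong           = ⊗-cong
      ; *-assoc          = ⊗-assoc
      ; *-identity       = comm∧idˡ⇒id {_⊗_} ⊗-comm {𝟙} ⊗-identityˡ
      ; distrib          = comm∧distrʳ⇒distr {_⊗_} {_⊕_} zxyα.+-cong ⊗-comm ⊗-distribʳ
      }
    ; *-comm = ⊗-comm
    }
    where open import Algebra.Consequences.Setoid zxyα.setoid using (comm∧idˡ⇒id; comm∧distrʳ⇒distr)

  -- Opaque copies of the operations, so that equations between ring expressions are
  -- checked without unfolding the Cauchy products.
  opaque
    infixl 6 _+ˢ_
    infixl 7 _*ˢ_
    _+ˢ_ _*ˢ_ : Ser → Ser → Ser
    _+ˢ_ = _⊕_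
    _*ˢ_ = _⊗_

    -ˢ_ : Ser → Ser
    -ˢ_ = zxyα.-_

    0ˢ 1ˢ : Ser
    0ˢ = zxyα.0#
    1ˢ = 𝟙

  opaque
    unfolding _+ˢ_ _*ˢ_ -ˢ_ 0ˢ 1ˢ
    isCommutativeRingˢ : IsCommutativeRing _≈_ _+ˢ_ _*ˢ_ -ˢ_ 0ˢ 1ˢ
    isCommutativeRingˢ = ⊗-isCommutativeRing

  Series : CommutativeRing 0ℓ 0ℓ
  Series = record { isCommutativeRing = isCommutativeRingˢ }

  open CommutativeRing Series using (_+_; _*_; -_; 0#; 1#)
  open import Algebra.Properties.Semiring.Exp (CommutativeRing.semiring Series) using () renaming (_^_ to _^ˢ_)

  opaque
    unfolding _+ˢ_ _*ˢ_ -ˢ_ 0ˢ 1ˢ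

    +≈⊕ : ∀ F G → F + G ≈ F ⊕ G
    +≈⊕ F G n a b c = refl

    *≈⊗ : ∀ F G → F * G ≈ F ⊗ G
    *≈⊗ F G n a b c = refl

    1≈𝟙 : 1# ≈ 𝟙
    1≈𝟙 n a b c = refl

    -‿coefficient : ∀ F n a b c → (- F) n a b c ≡ ℚ.- F n a b c
    -‿coefficient F n a b c = refl

    0-coefficient : ∀ n a b c → 0# n a b c ≡ 0ℚ
    0-coefficient n a b c = refl

    ^≈^ˢ : ∀ F k → F ^ k ≈ F ^ˢ k
    ^≈^ˢ F zero    = λ n a b c → refl
    ^≈^ˢ F (suc k) = ⊗-cong {F} {F} (λ n a b c → refl) (^≈^ˢ F k)

  private
    module SeriesΣ = FiniteSums (CommutativeRing.commutativeSemiring Series)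

  sumBelow-coefficient : ∀ t (g : ℕ → Ser) n a b c → SeriesΣ.sumBelow t g n a b c ≡ ℚΣ.sumBelow t (λ j → g j n a b c)
  sumBelow-coefficient zero    g n a b c = 0-coefficient n a b c
  sumBelow-coefficient (suc t) g n a b c =
    trans (+≈⊕ (SeriesΣ.sumBelow t g) (g t) n a b c) (cong (ℚ._+ g t n a b c) (sumBelow-coefficient t g n a b c))

  +≈⊕-cong : ∀ {F F′ G G′} → F ≈ F′ → G ≈ G′ → F + G ≈ F′ ⊕ G′
  +≈⊕-cong F≈F′ G≈G′ = CommutativeRing.trans Series (CommutativeRing.+-cong Series F≈F′ G≈G′) (+≈⊕ _ _)

module Shifts where

  open import Defs hiding (_^_)
  open SeriesRing using (sumTo-zero; sumTo-single; Series; *≈⊗; +≈⊕; 0-coefficient)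
  open import Algebra.Bundles using (CommutativeRing)
  open CommutativeRing Series using (_+_; _*_; 0#)
  private module S = CommutativeRing Series
  open import Algebra.Properties.Semiring.Exp (CommutativeRing.semiring Series) using (_^_)
  open IntegerCoefficientSolver Series using (solve; _:+_; _:*_; _:=_)
  open import Data.Empty using (⊥; ⊥-elim)
  open import Data.Nat as ℕ using (ℕ; zero; suc; _∸_; _≤_; _<_; z≤n; s≤s)
  open import Data.Nat.Induction using (<-rec)
  open import Data.Nat.Properties using (m∸n≤m; <⇒≢; ≤-<-trans)
  open import Data.Product using (_×_; _,_)
  open import Data.Rational as ℚ using (ℚ; 0ℚ; 1ℚ)
  import Data.Rational.Properties as ℚ
  open import Data.Sum using (_⊎_; inj₁; inj₂)
  open import Relation.Nullary using (yes; no; ¬_)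
  open import Relation.Binary.PropositionalEquality using (_≡_; refl; cong; cong₂; trans; sym; module ≡-Reasoning)
  open ≡-Reasoning

  shiftZ shiftX shiftY shiftA : Ser → Ser
  shiftZ F zero    a b c = 0ℚ
  shiftZ F (suc n) a b c = F n a b c
  shiftX F n zero    b c = 0ℚ
  shiftX F n (suc a) b c = F n a b c
  shiftY F n a zero    c = 0ℚ
  shiftY F n a (suc b) c = F n a b c
  shiftA F n a b zero    = 0ℚ
  shiftA F n a b (suc c) = F n a b c

  mono-diagonal : ∀ p q r s → mono p q r s p q r s ≡ 1ℚ
  mono-diagonal p q r s with p ℕ.≟ p | q ℕ.≟ q | r ℕ.≟ r | s ℕ.≟ s
  ... | yes _ | yes _ | yes _ | yes _ = refl
  ... | no p≢p | _     | _     | _     = ⊥-elim (p≢p refl)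
  ... | yes _ | no q≢q | _     | _     = ⊥-elim (q≢q refl)
  ... | yes _ | yes _ | no r≢r | _     = ⊥-elim (r≢r refl)
  ... | yes _ | yes _ | yes _ | no s≢s = ⊥-elim (s≢s refl)

  mono-off-diagonal : ∀ p q r s i j k l → ¬ (p ≡ i × q ≡ j × r ≡ k × s ≡ l) → mono p q r s i j k l ≡ 0ℚ
  mono-off-diagonal p q r s i j k l ≢ with p ℕ.≟ i | q ℕ.≟ j | r ℕ.≟ k | s ℕ.≟ l
  ... | yes p≡i | yes q≡j | yes r≡k | yes s≡l = ⊥-elim (≢ (p≡i , q≡j , r≡k , s≡l))
  ... | no _    | _       | _       | _       = refl
  ... | yes _   | no _    | _       | _       = refl
  ... | yes _   | yes _   | no _    | _       = refl
  ... | yes _   | yes _   | yes _   | no _    = refl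

  private
    0*x≡0 : ∀ {u} v → u ≡ 0ℚ → u ℚ.* v ≡ 0ℚ
    0*x≡0 v refl = ℚ.*-zeroˡ v

  mono-⊗-inside : ∀ p q r s F n a b c → p ≤ n → q ≤ a → r ≤ b → s ≤ c →
    (mono p q r s ⊗ F) n a b c ≡ F (n ∸ p) (a ∸ q) (b ∸ r) (c ∸ s)
  mono-⊗-inside p q r s F n a b c p≤n q≤a r≤b s≤c =
    trans (sumTo-single n p p≤n (λ i _ p≢i → sumTo-zero a (λ j _ → sumTo-zero b (λ k _ → sumTo-zero c (λ l _ →
      0*x≡0 _ (mono-off-diagonal p q r s i j k l (λ (i≡p , _) → p≢i (sym i≡p))))))))
    (trans (sumTo-single a q q≤a (λ j _ q≢j → sumTo-zero b (λ k _ → sumTo-zero c (λ l _ →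
      0*x≡0 _ (mono-off-diagonal p q r s p j k l (λ (_ , j≡q , _) → q≢j (sym j≡q)))))))
    (trans (sumTo-single b r r≤b (λ k _ r≢k → sumTo-zero c (λ l _ →
      0*x≡0 _ (mono-off-diagonal p q r s p q k l (λ (_ , _ , k≡r , _) → r≢k (sym k≡r))))))
    (trans (sumTo-single c s s≤c (λ l _ s≢l →
      0*x≡0 _ (mono-off-diagonal p q r s p q r l (λ (_ , _ , _ , l≡s) → s≢l (sym l≡s)))))
    (trans (cong (ℚ._* F (n ∸ p) (a ∸ q) (b ∸ r) (c ∸ s)) (mono-diagonal p q r s)) (ℚ.*-identityˡ _)))))

  mono-⊗-outside : ∀ p q r s F n a b c → n < p ⊎ a < q ⊎ b < r ⊎ c < s → (mono p q r s ⊗ F) n a b c ≡ 0ℚ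
  mono-⊗-outside p q r s F n a b c outside =
    sumTo-zero n (λ i i≤n → sumTo-zero a (λ j j≤a → sumTo-zero b (λ k k≤b → sumTo-zero c (λ l l≤c →
      0*x≡0 _ (mono-off-diagonal p q r s i j k l (λ (p≡i , q≡j , r≡k , s≡l) →
        missed outside i≤n j≤a k≤b l≤c p≡i q≡j r≡k s≡l))))))
    where
    missed : ∀ {i j k l} → n < p ⊎ a < q ⊎ b < r ⊎ c < s → i ≤ n → j ≤ a → k ≤ b → l ≤ c →
             p ≡ i → q ≡ j → r ≡ k → s ≡ l → ⊥
    missed (inj₁ n<p)                 i≤n _   _   _   p≡i _   _   _   = <⇒≢ (≤-<-trans i≤n n<p) (sym p≡i)
    missed (inj₂ (inj₁ a<q))          _   j≤a _   _   _   q≡j _   _   = <⇒≢ (≤-<-trans j≤a a<q) (sym q≡j)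
    missed (inj₂ (inj₂ (inj₁ b<r)))   _   _   k≤b _   _   _   r≡k _   = <⇒≢ (≤-<-trans k≤b b<r) (sym r≡k)
    missed (inj₂ (inj₂ (inj₂ c<s)))   _   _   _   l≤c _   _   _   s≡l = <⇒≢ (≤-<-trans l≤c c<s) (sym s≡l)

  Zs⊗≈shiftZ : ∀ F → Zs ⊗ F ≈ shiftZ F
  Zs⊗≈shiftZ F zero    a b c = mono-⊗-outside 1 0 0 0 F zero a b c (inj₁ (s≤s z≤n))
  Zs⊗≈shiftZ F (suc n) a b c = mono-⊗-inside 1 0 0 0 F (suc n) a b c (s≤s z≤n) z≤n z≤n z≤n

  Xs⊗≈shiftX : ∀ F → Xs ⊗ F ≈ shiftX F
  Xs⊗≈shiftX F n zero    b c = mono-⊗-outside 0 1 0 0 F n zero b c (inj₂ (inj₁ (s≤s z≤n)))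
  Xs⊗≈shiftX F n (suc a) b c = mono-⊗-inside 0 1 0 0 F n (suc a) b c z≤n (s≤s z≤n) z≤n z≤n

  Ys⊗≈shiftY : ∀ F → Ys ⊗ F ≈ shiftY F
  Ys⊗≈shiftY F n a zero    c = mono-⊗-outside 0 0 1 0 F n a zero c (inj₂ (inj₂ (inj₁ (s≤s z≤n))))
  Ys⊗≈shiftY F n a (suc b) c = mono-⊗-inside 0 0 1 0 F n a (suc b) c z≤n z≤n (s≤s z≤n) z≤n

  As⊗≈shiftA : ∀ F → As ⊗ F ≈ shiftA F
  As⊗≈shiftA F n a b zero    = mono-⊗-outside 0 0 0 1 F n a b zero (inj₂ (inj₂ (inj₂ (s≤s z≤n))))
  As⊗≈shiftA F n a b (suc c) = mono-⊗-inside 0 0 0 1 F n a b (suc c) z≤n z≤n z≤n (s≤s z≤n)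

  shiftZ-cong : ∀ {F G} → F ≈ G → shiftZ F ≈ shiftZ G
  shiftZ-cong F≈G zero    a b c = refl
  shiftZ-cong F≈G (suc n) a b c = F≈G n a b c

  shiftX-cong : ∀ {F G} → F ≈ G → shiftX F ≈ shiftX G
  shiftX-cong F≈G n zero    b c = refl
  shiftX-cong F≈G n (suc a) b c = F≈G n a b c

  shiftY-cong : ∀ {F G} → F ≈ G → shiftY F ≈ shiftY G
  shiftY-cong F≈G n a zero    c = refl
  shiftY-cong F≈G n a (suc b) c = F≈G n a b c

  shiftA-cong : ∀ {F G} → F ≈ G → shiftA F ≈ shiftA G
  shiftA-cong F≈G n a b zero    = refl
  shiftA-cong F≈G n a b (suc c) = F≈G n a b c

  Zs*≈shiftZ : ∀ F → Zs * F ≈ shiftZ F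
  Zs*≈shiftZ F = S.trans (*≈⊗ Zs F) (Zs⊗≈shiftZ F)

  Xs*≈shiftX : ∀ F → Xs * F ≈ shiftX F
  Xs*≈shiftX F = S.trans (*≈⊗ Xs F) (Xs⊗≈shiftX F)

  Ys*≈shiftY : ∀ F → Ys * F ≈ shiftY F
  Ys*≈shiftY F = S.trans (*≈⊗ Ys F) (Ys⊗≈shiftY F)

  As*≈shiftA : ∀ F → As * F ≈ shiftA F
  As*≈shiftA F = S.trans (*≈⊗ As F) (As⊗≈shiftA F)

  shiftZ^ shiftA^ : ℕ → Ser → Ser
  shiftZ^ zero    F = F
  shiftZ^ (suc p) F = shiftZ (shiftZ^ p F)
  shiftA^ zero    F = F
  shiftA^ (suc q) F = shiftA (shiftA^ q F)

  Zs^*≈shiftZ^ : ∀ p F → Zs ^ p * F ≈ shiftZ^ p F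
  Zs^*≈shiftZ^ zero    F = S.*-identityˡ F
  Zs^*≈shiftZ^ (suc p) F = S.trans (S.*-assoc Zs (Zs ^ p) F) (S.trans (Zs*≈shiftZ _) (shiftZ-cong (Zs^*≈shiftZ^ p F)))

  As^*≈shiftA^ : ∀ q F → As ^ q * F ≈ shiftA^ q F
  As^*≈shiftA^ zero    F = S.*-identityˡ F
  As^*≈shiftA^ (suc q) F = S.trans (S.*-assoc As (As ^ q) F) (S.trans (As*≈shiftA _) (shiftA-cong (As^*≈shiftA^ q F)))

  shiftZ^-cong : ∀ p {F G} → F ≈ G → shiftZ^ p F ≈ shiftZ^ p G
  shiftZ^-cong zero    F≈G = F≈G
  shiftZ^-cong (suc p) F≈G = shiftZ-cong (shiftZ^-cong p F≈G)

  shiftA^-cong : ∀ q {F G} → F ≈ G → shiftA^ q F ≈ shiftA^ q G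
  shiftA^-cong zero    F≈G = F≈G
  shiftA^-cong (suc q) F≈G = shiftA-cong (shiftA^-cong q F≈G)

  shiftZ^-+ : ∀ p F m a b c → shiftZ^ p F (p ℕ.+ m) a b c ≡ F m a b c
  shiftZ^-+ zero    F m a b c = refl
  shiftZ^-+ (suc p) F m a b c = shiftZ^-+ p F m a b c

  shiftZ^-< : ∀ p F n a b c → n < p → shiftZ^ p F n a b c ≡ 0ℚ
  shiftZ^-< (suc p) F zero    a b c _         = refl
  shiftZ^-< (suc p) F (suc n) a b c (s≤s n<p) = shiftZ^-< p F n a b c n<p

  shiftA^-+ : ∀ q F n a b e → shiftA^ q F n a b (q ℕ.+ e) ≡ F n a b e
  shiftA^-+ zero    F n a b e = refl
  shiftA^-+ (suc q) F n a b e = shiftA^-+ q F n a b e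

  shiftA^-< : ∀ q F n a b e → e < q → shiftA^ q F n a b e ≡ 0ℚ
  shiftA^-< (suc q) F n a b zero    _         = refl
  shiftA^-< (suc q) F n a b (suc e) (s≤s e<q) = shiftA^-< q F n a b e e<q

  ⊗-vanishes : ∀ F G n → (∀ m → m ≤ n → ∀ a b c → G m a b c ≡ 0ℚ) → ∀ a b c → (F ⊗ G) n a b c ≡ 0ℚ
  ⊗-vanishes F G n G≡0 a b c =
    sumTo-zero n (λ i _ → sumTo-zero a (λ j _ → sumTo-zero b (λ k _ → sumTo-zero c (λ l _ →
      trans (cong (F i j k l ℚ.*_) (G≡0 (n ∸ i) (m∸n≤m n i) (a ∸ j) (b ∸ k) (c ∸ l))) (ℚ.*-zeroʳ (F i j k l))))))

  -- At x^(a+1) z^n the hypothesis expresses G's coefficient at x^a z^n through coefficients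
  -- of G of lower z-degree.
  x+zF-cancellative : ∀ F G → G * (Xs + Zs * F) ≈ 0# → G ≈ 0#
  x+zF-cancellative F G G[x+zF]≈0 n a b c = trans (<-rec _ step n a b c) (sym (0-coefficient n a b c))
    where
    xG+zFG≡0 : ∀ n a b c → shiftX G n a b c ℚ.+ shiftZ (F ⊗ G) n a b c ≡ 0ℚ
    xG+zFG≡0 n a b c = begin
      shiftX G n a b c ℚ.+ shiftZ (F ⊗ G) n a b c
        ≡⟨ cong₂ ℚ._+_ (Xs*≈shiftX G n a b c) (trans (Zs*≈shiftZ (F * G) n a b c) (shiftZ-cong (*≈⊗ F G) n a b c)) ⟨
      (Xs * G) n a b c ℚ.+ (Zs * (F * G)) n a b c ≡⟨ +≈⊕ (Xs * G) (Zs * (F * G)) n a b c ⟨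
      (Xs * G + Zs * (F * G)) n a b c           ≡⟨ expand Xs Zs F G n a b c ⟨
      (G * (Xs + Zs * F)) n a b c               ≡⟨ G[x+zF]≈0 n a b c ⟩
      0# n a b c                                ≡⟨ 0-coefficient n a b c ⟩
      0ℚ                                        ∎
      where
      expand : ∀ x z f g → g * (x + z * f) ≈ x * g + z * (f * g)
      expand = solve 4 (λ x z f g → g :* (x :+ z :* f) := x :* g :+ z :* (f :* g)) S.refl
    x+0≡0 : ∀ {x y} → x ℚ.+ y ≡ 0ℚ → y ≡ 0ℚ → x ≡ 0ℚ
    x+0≡0 {x} x+y≡0 refl = trans (sym (ℚ.+-identityʳ x)) x+y≡0
    step : ∀ n → (∀ {m} → m < n → ∀ a b c → G m a b c ≡ 0ℚ) → ∀ a b c → G n a b c ≡ 0ℚ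
    step zero    _  a b c = x+0≡0 (xG+zFG≡0 zero (suc a) b c) refl
    step (suc n) ih a b c =
      x+0≡0 (xG+zFG≡0 (suc n) (suc a) b c) (⊗-vanishes F G n (λ m m≤n → ih (s≤s m≤n)) (suc a) b c)

module Recurrences where

  open import Defs
  open Shifts
  open import Data.Nat using (ℕ; zero; suc; _<_)
  open import Data.Nat.Induction using (<-rec)
  open import Data.Nat.Properties using (n<1+n; m<n⇒m<1+n)
  import Data.Rational as ℚ
  open import Relation.Binary.PropositionalEquality using (_≡_; refl; cong₂; trans; sym)

  -- The recurrences satisfied by H k L = W^k M^(L+1) V; the right-hand sides only involve
  -- coefficients of lower z-degree or smaller (k, L), so they determine H.
  record WMVRecurrence (H : ℕ → ℕ → Ser) : Set where
    field
      step-k : ∀ k L → H (suc k) L ≈ H k L ⊕ shiftY (shiftZ (H (suc k) L))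
      step-L : ∀ L → H 0 (suc L) ≈ H 0 L ⊕ shiftX (shiftZ (H 0 (suc L))) ⊕ shiftY (shiftZ (H 0 (suc L)))
                                         ⊕ shiftA (shiftZ (shiftZ (H 0 (suc (suc L)))))
      base   : H 0 0 ≈ 𝟙 ⊕ shiftX (shiftZ (H 0 0)) ⊕ shiftY (shiftZ (H 0 0))
                         ⊕ shiftA (shiftZ (shiftZ (H 0 1))) ⊕ shiftA (shiftZ (shiftZ (H 0 1)))

  private
    record AgreeAt (m : ℕ) (F G : Ser) : Set where
      constructor agreeAt
      field at : ∀ a b c → F m a b c ≡ G m a b c

    AgreeBelow : ℕ → Ser → Ser → Set
    AgreeBelow m F G = ∀ {m′} → m′ < m → AgreeAt m′ F G

    infixl 6 _⊕-agree_
    _⊕-agree_ : ∀ {m F F′ G G′} → AgreeAt m F F′ → AgreeAt m G G′ → AgreeAt m (F ⊕ G) (F′ ⊕ G′)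
    agreeAt F≡F′ ⊕-agree agreeAt G≡G′ = agreeAt λ a b c → cong₂ ℚ._+_ (F≡F′ a b c) (G≡G′ a b c)

    through : ∀ {m F F′ G G′} → F ≈ F′ → G ≈ G′ → AgreeAt m F′ G′ → AgreeAt m F G
    through {m} F≈F′ G≈G′ (agreeAt F′≡G′) =
      agreeAt λ a b c → trans (F≈F′ m a b c) (trans (F′≡G′ a b c) (sym (G≈G′ m a b c)))

    shiftX-agree : ∀ {m F G} → AgreeAt m F G → AgreeAt m (shiftX F) (shiftX G)
    shiftX-agree (agreeAt F≡G) = agreeAt λ { zero b c → refl ; (suc a) b c → F≡G a b c }

    shiftY-agree : ∀ {m F G} → AgreeAt m F G → AgreeAt m (shiftY F) (shiftY G)
    shiftY-agree (agreeAt F≡G) = agreeAt λ { a zero c → refl ; a (suc b) c → F≡G a b c }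

    shiftA-agree : ∀ {m F G} → AgreeAt m F G → AgreeAt m (shiftA F) (shiftA G)
    shiftA-agree (agreeAt F≡G) = agreeAt λ { a b zero → refl ; a b (suc c) → F≡G a b c }

    shiftZ-agree : ∀ {m F G} → AgreeBelow m F G → AgreeAt m (shiftZ F) (shiftZ G)
    shiftZ-agree {zero}  below = agreeAt λ _ _ _ → refl
    shiftZ-agree {suc m} below = agreeAt (AgreeAt.at (below (n<1+n m)))

    shiftZ²-agree : ∀ {m F G} → AgreeBelow m F G → AgreeAt m (shiftZ (shiftZ F)) (shiftZ (shiftZ G))
    shiftZ²-agree {zero}        below = agreeAt λ _ _ _ → refl
    shiftZ²-agree {suc zero}    below = agreeAt λ _ _ _ → refl
    shiftZ²-agree {suc (suc m)} below = agreeAt (AgreeAt.at (below (m<n⇒m<1+n (n<1+n m))))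

  WMVRecurrence-unique : ∀ {H K} → WMVRecurrence H → WMVRecurrence K → ∀ k L → H k L ≈ K k L
  WMVRecurrence-unique {H} {K} recH recK k L m = AgreeAt.at (<-rec _ agree m k L)
    where
    module H = WMVRecurrence recH
    module K = WMVRecurrence recK
    agree : ∀ m → (∀ {m′} → m′ < m → ∀ k L → AgreeAt m′ (H k L) (K k L)) → ∀ k L → AgreeAt m (H k L) (K k L)
    agree m below = agree-k
      where
      xz : ∀ k L → AgreeAt m (shiftX (shiftZ (H k L))) (shiftX (shiftZ (K k L)))
      xz k L = shiftX-agree (shiftZ-agree (λ m′<m → below m′<m k L))
      yz : ∀ k L → AgreeAt m (shiftY (shiftZ (H k L))) (shiftY (shiftZ (K k L)))
      yz k L = shiftY-agree (shiftZ-agree (λ m′<m → below m′<m k L))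
      azz : ∀ k L → AgreeAt m (shiftA (shiftZ (shiftZ (H k L)))) (shiftA (shiftZ (shiftZ (K k L))))
      azz k L = shiftA-agree (shiftZ²-agree (λ m′<m → below m′<m k L))
      agree-L : ∀ L → AgreeAt m (H 0 L) (K 0 L)
      agree-L zero    = through H.base K.base
        (agreeAt {F = 𝟙} {G = 𝟙} (λ _ _ _ → refl) ⊕-agree xz 0 0 ⊕-agree yz 0 0 ⊕-agree azz 0 1 ⊕-agree azz 0 1)
      agree-L (suc L) = through (H.step-L L) (K.step-L L)
        (agree-L L ⊕-agree xz 0 (suc L) ⊕-agree yz 0 (suc L) ⊕-agree azz 0 (suc (suc L)))
      agree-k : ∀ k L → AgreeAt m (H k L) (K k L)
      agree-k zero    L = agree-L L
      agree-k (suc k) L = through (H.step-k k L) (K.step-k k L) (agree-k k L ⊕-agree yz (suc k) L)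

module Multinomials where

  open import Data.Nat using (ℕ; zero; suc; _+_; _*_; _≤_; z≤n; s≤s; _!; NonZero)
  open import Data.Nat.Properties
  open import Data.Nat.Tactic.RingSolver using (solve-∀)
  open import Relation.Binary.PropositionalEquality
    using (_≡_; refl; cong; cong₂; trans; sym; subst; module ≡-Reasoning)
  open ≡-Reasoning
  open FiniteSums +-*-commutativeSemiring using (sumBelow)

  -- binomial x y = (x + y)! / (x! y!) (see binomial-!); trinomial and quadrinomial below
  -- are indexed by their parts in the same way.
  binomial : ℕ → ℕ → ℕ
  binomial zero    y       = 1
  binomial (suc x) zero    = 1
  binomial (suc x) (suc y) = binomial x (suc y) + binomial (suc x) y

  atPred : ℕ → (ℕ → ℕ) → ℕ
  atPred zero    f = 0
  atPred (suc x) f = f x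

  atPred-cong : ∀ x {f g : ℕ → ℕ} → (∀ y → suc y ≡ x → f y ≡ g y) → atPred x f ≡ atPred x g
  atPred-cong zero    f≡g = refl
  atPred-cong (suc x) f≡g = f≡g x refl

  atPred-*ˡ : ∀ x k (f : ℕ → ℕ) → atPred x (λ y → k * f y) ≡ k * atPred x f
  atPred-*ˡ zero    k f = sym (*-zeroʳ k)
  atPred-*ˡ (suc x) k f = refl

  binomial-zeroʳ : ∀ x → binomial x 0 ≡ 1
  binomial-zeroʳ zero    = refl
  binomial-zeroʳ (suc x) = refl

  binomial-comm : ∀ x y → binomial x y ≡ binomial y x
  binomial-comm zero    zero    = refl
  binomial-comm zero    (suc y) = refl
  binomial-comm (suc x) zero    = refl
  binomial-comm (suc x) (suc y) =
    trans (cong₂ _+_ (binomial-comm x (suc y)) (binomial-comm (suc x) y)) (+-comm (binomial (suc y) x) _)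

  binomial-pascal : ∀ x y → 1 ≤ x + y →
    binomial x y ≡ atPred x (λ x′ → binomial x′ y) + atPred y (binomial x)
  binomial-pascal zero    (suc y) _ = refl
  binomial-pascal (suc x) zero    _ = sym (trans (+-identityʳ (binomial x 0)) (binomial-zeroʳ x))
  binomial-pascal (suc x) (suc y) _ = refl

  binomial-! : ∀ x y → binomial x y * (x ! * y !) ≡ (x + y) !
  binomial-! zero    y       = trans (*-identityˡ _) (*-identityˡ _)
  binomial-! (suc x) zero    = trans (*-identityˡ _) (trans (*-identityʳ _) (cong _! (sym (+-identityʳ (suc x)))))
  binomial-! (suc x) (suc y) = begin
    (binomial x (suc y) + binomial (suc x) y) * (suc x ! * suc y !)
      ≡⟨ split (binomial x (suc y)) (binomial (suc x) y) (x !) (y !) x y ⟩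
    binomial x (suc y) * (x ! * suc y !) * suc x + binomial (suc x) y * (suc x ! * y !) * suc y
      ≡⟨ cong₂ _+_ (cong (_* suc x) (binomial-! x (suc y))) (cong (_* suc y) (binomial-! (suc x) y)) ⟩
    (x + suc y) ! * suc x + suc (x + y) ! * suc y
      ≡⟨ cong (λ u → u ! * suc x + suc (x + y) ! * suc y) (+-suc x y) ⟩
    suc (x + y) ! * suc x + suc (x + y) ! * suc y
      ≡⟨ collect (suc (x + y) !) x y ⟩
    suc (suc (x + y)) * suc (x + y) !
      ≡⟨ cong (λ u → suc u !) (sym (+-suc x y)) ⟩
    (suc x + suc y) ! ∎
    where
    split : ∀ p q fx fy x y → (p + q) * ((suc x * fx) * (suc y * fy)) ≡
            p * (fx * (suc y * fy)) * suc x + q * ((suc x * fx) * fy) * suc y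
    split = solve-∀
    collect : ∀ F x y → F * suc x + F * suc y ≡ suc (suc (x + y)) * F
    collect = solve-∀

  trinomial : ℕ → ℕ → ℕ → ℕ
  trinomial a c d = binomial a (c + d) * binomial c d

  trinomial-pascal : ∀ a c d → 1 ≤ a + c + d →
    trinomial a c d ≡
      atPred a (λ a′ → trinomial a′ c d) + atPred c (λ c′ → trinomial a c′ d) + atPred d (trinomial a c)
  trinomial-pascal zero c d 1≤c+d = begin
    1 * binomial c d                                                     ≡⟨ *-identityˡ _ ⟩
    binomial c d                                                         ≡⟨ binomial-pascal c d 1≤c+d ⟩
    atPred c (λ c′ → binomial c′ d) + atPred d (binomial c)              ≡⟨ cong₂ _+_ (1*-atPred c) (1*-atPred d) ⟨
    atPred c (λ c′ → 1 * binomial c′ d) + atPred d (λ d′ → 1 * binomial c d′) ∎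
    where
    1*-atPred : ∀ x {f : ℕ → ℕ} → atPred x (λ y → 1 * f y) ≡ atPred x f
    1*-atPred x {f} = trans (atPred-*ˡ x 1 f) (*-identityˡ _)
  trinomial-pascal (suc a) zero zero _ = sym (trans (lemma (binomial a 0)) (binomial-zeroʳ a))
    where
    lemma : ∀ x → x * 1 + 0 + 0 ≡ x
    lemma = solve-∀
  trinomial-pascal (suc a) zero (suc d) _ = lemma (binomial a (suc d)) (binomial (suc a) d)
    where
    lemma : ∀ x y → (x + y) * 1 ≡ x * 1 + 0 + y * 1
    lemma = solve-∀
  trinomial-pascal (suc a) (suc c) d _ = begin
    (binomial a (suc (c + d)) + binomial (suc a) (c + d)) * binomial (suc c) d
      ≡⟨ *-distribʳ-+ (binomial (suc c) d) (binomial a (suc (c + d))) _ ⟩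
    X + binomial (suc a) (c + d) * binomial (suc c) d
      ≡⟨ cong (λ v → X + binomial (suc a) (c + d) * v) (binomial-pascal (suc c) d (s≤s z≤n)) ⟩
    X + binomial (suc a) (c + d) * (binomial c d + atPred d (binomial (suc c)))
      ≡⟨ lemma X (binomial (suc a) (c + d)) (binomial c d) (atPred d (binomial (suc c))) ⟩
    X + trinomial (suc a) c d + binomial (suc a) (c + d) * atPred d (binomial (suc c))
      ≡⟨ cong (X + trinomial (suc a) c d +_) (sym (atPred-*ˡ d (binomial (suc a) (c + d)) (binomial (suc c)))) ⟩
    X + trinomial (suc a) c d + atPred d (λ d′ → binomial (suc a) (c + d) * binomial (suc c) d′)
      ≡⟨ cong (X + trinomial (suc a) c d +_) (atPred-cong d (λ d′ 1+d′≡d →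
           cong (λ v → binomial (suc a) v * binomial (suc c) d′) (trans (cong (c +_) (sym 1+d′≡d)) (+-suc c d′)))) ⟩
    X + trinomial (suc a) c d + atPred d (trinomial (suc a) (suc c)) ∎
    where
    X = trinomial a (suc c) d
    lemma : ∀ x y z g → x + y * (z + g) ≡ x + y * z + y * g
    lemma = solve-∀

  trinomial-! : ∀ a c d → trinomial a c d * (a ! * c ! * d !) ≡ (a + c + d) !
  trinomial-! a c d = begin
    binomial a (c + d) * binomial c d * (a ! * c ! * d !)
      ≡⟨ regroup (binomial a (c + d)) (binomial c d) (a !) (c !) (d !) ⟩
    binomial a (c + d) * (a ! * (binomial c d * (c ! * d !)))
      ≡⟨ cong (λ v → binomial a (c + d) * (a ! * v)) (binomial-! c d) ⟩
    binomial a (c + d) * (a ! * (c + d) !)                    ≡⟨ binomial-! a (c + d) ⟩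
    (a + (c + d)) !                                           ≡⟨ cong _! (sym (+-assoc a c d)) ⟩
    (a + c + d) !                                             ∎
    where
    regroup : ∀ p q x y z → p * q * (x * y * z) ≡ p * (x * (q * (y * z)))
    regroup = solve-∀

  binomial-sucˡ : ∀ x y → binomial (suc x) y ≡ binomial x y + atPred y (binomial (suc x))
  binomial-sucˡ x zero    = sym (trans (+-identityʳ _) (binomial-zeroʳ x))
  binomial-sucˡ x (suc y) = refl

  private
    atPred-positive-*-trinomial : ∀ a c d (g : ℕ → ℕ) {R} → a + c + d ≡ suc R → g R * trinomial a c d ≡
      atPred a (λ a′ → g (a′ + c + d) * trinomial a′ c d) + atPred c (λ c′ → g (a + c′ + d) * trinomial a c′ d)
        + atPred d (λ d′ → g (a + c + d′) * trinomial a c d′)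
    atPred-positive-*-trinomial a c d g {R} a+c+d≡1+R = begin
      g R * trinomial a c d
        ≡⟨ cong (g R *_) (trinomial-pascal a c d (subst (1 ≤_) (sym a+c+d≡1+R) (s≤s z≤n))) ⟩
      g R * (A + C + D)
        ≡⟨ trans (*-distribˡ-+ (g R) (A + C) D) (cong (_+ g R * D) (*-distribˡ-+ (g R) A C)) ⟩
      g R * A + g R * C + g R * D
        ≡⟨ cong₂ _+_ (cong₂ _+_ (pull a (λ a′ → a′ + c + d) (λ a′ → trinomial a′ c d) index-a)
                                (pull c (λ c′ → a + c′ + d) (λ c′ → trinomial a c′ d) index-c))
                     (pull d (λ d′ → a + c + d′) (trinomial a c) index-d) ⟩
      atPred a (λ a′ → g (a′ + c + d) * trinomial a′ c d) + atPred c (λ c′ → g (a + c′ + d) * trinomial a c′ d)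
        + atPred d (λ d′ → g (a + c + d′) * trinomial a c d′) ∎
      where
      A = atPred a (λ a′ → trinomial a′ c d)
      C = atPred c (λ c′ → trinomial a c′ d)
      D = atPred d (trinomial a c)
      pull : ∀ x (i f : ℕ → ℕ) → (∀ y → suc y ≡ x → R ≡ i y) →
             g R * atPred x f ≡ atPred x (λ y → g (i y) * f y)
      pull x i f R≡i = trans (sym (atPred-*ˡ x (g R) f))
                             (atPred-cong x (λ y 1+y≡x → cong (λ r → g r * f y) (R≡i y 1+y≡x)))
      index-a : ∀ a′ → suc a′ ≡ a → R ≡ a′ + c + d
      index-a a′ refl = suc-injective (sym a+c+d≡1+R)
      index-c : ∀ c′ → suc c′ ≡ c → R ≡ a + c′ + d
      index-c c′ refl = suc-injective (trans (sym a+c+d≡1+R) (cong (_+ d) (+-suc a c′)))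
      index-d : ∀ d′ → suc d′ ≡ d → R ≡ a + c + d′
      index-d d′ refl = suc-injective (trans (sym a+c+d≡1+R) (+-suc (a + c) d′))

  atPred-sum-*-trinomial : ∀ a c d (g : ℕ → ℕ) → atPred (a + c + d) g * trinomial a c d ≡
    atPred a (λ a′ → g (a′ + c + d) * trinomial a′ c d) + atPred c (λ c′ → g (a + c′ + d) * trinomial a c′ d)
      + atPred d (λ d′ → g (a + c + d′) * trinomial a c d′)
  atPred-sum-*-trinomial zero    zero    zero    g = refl
  atPred-sum-*-trinomial (suc a) c       d       g = atPred-positive-*-trinomial (suc a) c d g refl
  atPred-sum-*-trinomial zero    (suc c) d       g = atPred-positive-*-trinomial zero (suc c) d g refl
  atPred-sum-*-trinomial zero    zero    (suc d) g = atPred-positive-*-trinomial zero zero (suc d) g refl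

  quadrinomial : ℕ → ℕ → ℕ → ℕ → ℕ
  quadrinomial a b c d = binomial b (a + c + d) * trinomial a c d

  quadrinomial-pascal : ∀ a b c d → 1 ≤ a + b + c + d →
    quadrinomial a b c d ≡ atPred a (λ a′ → quadrinomial a′ b c d) + atPred b (λ b′ → quadrinomial a b′ c d)
                             + atPred c (λ c′ → quadrinomial a b c′ d) + atPred d (quadrinomial a b c)
  quadrinomial-pascal a zero c d 1≤a+0+c+d = begin
    1 * trinomial a c d
      ≡⟨ *-identityˡ _ ⟩
    trinomial a c d
      ≡⟨ trinomial-pascal a c d (subst (λ x → 1 ≤ x + c + d) (+-identityʳ a) 1≤a+0+c+d) ⟩
    atPred a (λ a′ → trinomial a′ c d) + atPred c (λ c′ → trinomial a c′ d) + atPred d (trinomial a c)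
      ≡⟨ cong₂ _+_ (cong₂ _+_ (trans (+-identityʳ _) (1*-atPred a)) (1*-atPred c)) (1*-atPred d) ⟨
    atPred a (λ a′ → 1 * trinomial a′ c d) + 0 + atPred c (λ c′ → 1 * trinomial a c′ d)
      + atPred d (λ d′ → 1 * trinomial a c d′) ∎
    where
    1*-atPred : ∀ x {f : ℕ → ℕ} → atPred x (λ y → 1 * f y) ≡ atPred x f
    1*-atPred x {f} = trans (atPred-*ˡ x 1 f) (*-identityˡ _)
  quadrinomial-pascal a (suc b) c d _ = begin
    binomial (suc b) (a + c + d) * trinomial a c d
      ≡⟨ cong (_* trinomial a c d) (binomial-sucˡ b (a + c + d)) ⟩
    (binomial b (a + c + d) + atPred (a + c + d) (binomial (suc b))) * trinomial a c d
      ≡⟨ *-distribʳ-+ (trinomial a c d) (binomial b (a + c + d)) _ ⟩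
    quadrinomial a b c d + atPred (a + c + d) (binomial (suc b)) * trinomial a c d
      ≡⟨ cong (quadrinomial a b c d +_) (atPred-sum-*-trinomial a c d (binomial (suc b))) ⟩
    quadrinomial a b c d + (atPred a (λ a′ → quadrinomial a′ (suc b) c d)
      + atPred c (λ c′ → quadrinomial a (suc b) c′ d) + atPred d (quadrinomial a (suc b) c))
      ≡⟨ reorder (quadrinomial a b c d) (atPred a (λ a′ → quadrinomial a′ (suc b) c d))
                 (atPred c (λ c′ → quadrinomial a (suc b) c′ d)) (atPred d (quadrinomial a (suc b) c)) ⟩
    atPred a (λ a′ → quadrinomial a′ (suc b) c d) + quadrinomial a b c d
      + atPred c (λ c′ → quadrinomial a (suc b) c′ d) + atPred d (quadrinomial a (suc b) c) ∎
    where
    reorder : ∀ q x y z → q + (x + y + z) ≡ x + q + y + z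
    reorder = solve-∀

  quadrinomial-swap : ∀ a b c d → quadrinomial a b c d ≡ quadrinomial a b d c
  quadrinomial-swap a b c d =
    cong₂ _*_ (cong (binomial b) (trans (+-assoc a c d) (trans (cong (a +_) (+-comm c d)) (sym (+-assoc a d c)))))
              (cong₂ _*_ (cong (binomial a) (+-comm c d)) (binomial-comm c d))

  trinomial-sucʳ : ∀ a c d → trinomial a c (suc d) * suc d ≡ trinomial a c d * (a + c + suc d)
  trinomial-sucʳ a c d = *-cancelʳ-≡ _ _ (a ! * c ! * d !) {{ !-product≢0 }} (begin
    trinomial a c (suc d) * suc d * (a ! * c ! * d !)   ≡⟨ regroup (trinomial a c (suc d)) (a !) (c !) (d !) d ⟩
    trinomial a c (suc d) * (a ! * c ! * suc d !)       ≡⟨ trinomial-! a c (suc d) ⟩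
    (a + c + suc d) !                                   ≡⟨ cong _! (+-suc (a + c) d) ⟩
    suc (a + c + d) * (a + c + d) !                     ≡⟨ cong₂ _*_ (sym (+-suc (a + c) d)) (sym (trinomial-! a c d)) ⟩
    (a + c + suc d) * (trinomial a c d * (a ! * c ! * d !)) ≡⟨ swap (a + c + suc d) (trinomial a c d) _ ⟩
    trinomial a c d * (a + c + suc d) * (a ! * c ! * d !) ∎)
    where
    !-product≢0 : NonZero (a ! * c ! * d !)
    !-product≢0 = m*n≢0 _ _ {{m*n≢0 _ _ {{a !≢0}} {{c !≢0}}}} {{d !≢0}}
    regroup : ∀ m x y z d → m * suc d * (x * y * z) ≡ m * (x * y * (suc d * z))
    regroup = solve-∀
    swap : ∀ k m f → k * (m * f) ≡ m * k * f
    swap = solve-∀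

  trinomial-telescope : ∀ a c R t →
    (a + c + 1) * sumBelow t (λ j → trinomial a c (R + j)) + trinomial a c R * R ≡ trinomial a c (R + t) * (R + t)
  trinomial-telescope a c R zero =
    trans (cong (_+ trinomial a c R * R) (*-zeroʳ (a + c + 1)))
          (cong₂ (λ u v → trinomial a c u * v) (sym (+-identityʳ R)) (sym (+-identityʳ R)))
  trinomial-telescope a c R (suc t) = begin
    (a + c + 1) * (S + T) + trinomial a c R * R       ≡⟨ regroup (a + c + 1) S T (trinomial a c R * R) ⟩
    ((a + c + 1) * S + trinomial a c R * R) + (a + c + 1) * T ≡⟨ cong (_+ (a + c + 1) * T) (trinomial-telescope a c R t) ⟩
    T * (R + t) + (a + c + 1) * T                     ≡⟨ collect T (R + t) (a + c) ⟩
    T * (a + c + suc (R + t))                         ≡⟨ trinomial-sucʳ a c (R + t) ⟨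
    trinomial a c (suc (R + t)) * suc (R + t)
      ≡⟨ cong₂ (λ u v → trinomial a c u * v) (sym (+-suc R t)) (sym (+-suc R t)) ⟩
    trinomial a c (R + suc t) * (R + suc t)           ∎
    where
    S = sumBelow t (λ j → trinomial a c (R + j))
    T = trinomial a c (R + t)
    regroup : ∀ k S T x → k * (S + T) + x ≡ (k * S + x) + k * T
    regroup = solve-∀
    collect : ∀ T r s → T * r + (s + 1) * T ≡ T * (s + suc r)
    collect = solve-∀

module WMVCoefficients where

  open Multinomials
  open import Data.Nat using (ℕ; zero; suc; _+_; _*_; _≤_; z≤n; s≤s)
  open import Data.Nat.Properties
  open import Data.Nat.Tactic.RingSolver using (solve-∀)
  open import Relation.Binary.PropositionalEquality using (_≡_; refl; cong; cong₂; trans; sym; subst; module ≡-Reasoning)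
  open ≡-Reasoning

  wmvCoefficient : ℕ → ℕ → ℕ → ℕ → ℕ → ℕ
  wmvCoefficient k L a b c = binomial b (a + c + (c + L) + k) * trinomial a c (c + L)

  wmvCoefficient-zero : ∀ L a b c → wmvCoefficient 0 L a b c ≡ quadrinomial a b c (c + L)
  wmvCoefficient-zero L a b c = cong (λ v → binomial b v * trinomial a c (c + L)) (+-identityʳ _)

  wmvCoefficient-suc-k : ∀ k L a b c →
    wmvCoefficient (suc k) L a b c ≡ wmvCoefficient k L a b c + atPred b (λ b′ → wmvCoefficient (suc k) L a b′ c)
  wmvCoefficient-suc-k k L a zero    c = sym (+-identityʳ _)
  wmvCoefficient-suc-k k L a (suc b) c = begin
    binomial (suc b) (X + suc k) * T                        ≡⟨ cong (λ v → binomial (suc b) v * T) (+-suc X k) ⟩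
    (binomial b (suc (X + k)) + binomial (suc b) (X + k)) * T ≡⟨ *-distribʳ-+ T (binomial b (suc (X + k))) _ ⟩
    binomial b (suc (X + k)) * T + binomial (suc b) (X + k) * T ≡⟨ +-comm (binomial b (suc (X + k)) * T) _ ⟩
    binomial (suc b) (X + k) * T + binomial b (suc (X + k)) * T
      ≡⟨ cong (λ v → binomial (suc b) (X + k) * T + binomial b v * T) (sym (+-suc X k)) ⟩
    binomial (suc b) (X + k) * T + binomial b (X + suc k) * T   ∎
    where
    X = a + c + (c + L)
    T = trinomial a c (c + L)

  wmvCoefficient-suc-L : ∀ L a b c → wmvCoefficient 0 (suc L) a b c ≡
    wmvCoefficient 0 L a b c + atPred a (λ a′ → wmvCoefficient 0 (suc L) a′ b c)
      + atPred b (λ b′ → wmvCoefficient 0 (suc L) a b′ c) + atPred c (λ c′ → wmvCoefficient 0 (suc (suc L)) a b c′)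
  wmvCoefficient-suc-L L a b c = begin
    wmvCoefficient 0 (suc L) a b c
      ≡⟨ trans (wmvCoefficient-zero (suc L) a b c) (cong (quadrinomial a b c) (+-suc c L)) ⟩
    quadrinomial a b c (suc (c + L))
      ≡⟨ quadrinomial-pascal a b c (suc (c + L)) (subst (1 ≤_) (sym (+-suc (a + b + c) (c + L))) (s≤s z≤n)) ⟩
    A + B + C + quadrinomial a b c (c + L)
      ≡⟨ rotate A B C (quadrinomial a b c (c + L)) ⟩
    quadrinomial a b c (c + L) + A + B + C
      ≡⟨ cong₂ _+_ (cong₂ _+_ (cong₂ _+_ (sym (wmvCoefficient-zero L a b c))
           (atPred-cong a (λ a′ _ → trans (cong (quadrinomial a′ b c) (sym (+-suc c L)))
                                          (sym (wmvCoefficient-zero (suc L) a′ b c)))))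
           (atPred-cong b (λ b′ _ → trans (cong (quadrinomial a b′ c) (sym (+-suc c L)))
                                          (sym (wmvCoefficient-zero (suc L) a b′ c)))))
           (atPred-cong c (λ c′ 1+c′≡c → trans (cong (quadrinomial a b c′) (index c′ 1+c′≡c))
                                              (sym (wmvCoefficient-zero (suc (suc L)) a b c′)))) ⟩
    wmvCoefficient 0 L a b c + atPred a (λ a′ → wmvCoefficient 0 (suc L) a′ b c)
      + atPred b (λ b′ → wmvCoefficient 0 (suc L) a b′ c) + atPred c (λ c′ → wmvCoefficient 0 (suc (suc L)) a b c′) ∎
    where
    A = atPred a (λ a′ → quadrinomial a′ b c (suc (c + L)))
    B = atPred b (λ b′ → quadrinomial a b′ c (suc (c + L)))
    C = atPred c (λ c′ → quadrinomial a b c′ (suc (c + L)))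
    rotate : ∀ x y z w → x + y + z + w ≡ w + x + y + z
    rotate = solve-∀
    index : ∀ c′ → suc c′ ≡ c → suc (c + L) ≡ c′ + suc (suc L)
    index c′ refl = sym (trans (+-suc c′ (suc L)) (cong suc (+-suc c′ L)))

  δ₀ : ℕ → ℕ → ℕ → ℕ
  δ₀ zero zero zero = 1
  δ₀ _    _    _    = 0

  private
    wmvCoefficient-base-positive : ∀ a b c → 1 ≤ a + b + c → wmvCoefficient 0 0 a b c ≡
      atPred a (λ a′ → wmvCoefficient 0 0 a′ b c) + atPred b (λ b′ → wmvCoefficient 0 0 a b′ c)
        + atPred c (λ c′ → wmvCoefficient 0 1 a b c′) + atPred c (λ c′ → wmvCoefficient 0 1 a b c′)
    wmvCoefficient-base-positive a b c 1≤a+b+c = begin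
      wmvCoefficient 0 0 a b c
        ≡⟨ wmvCoefficient-zero 0 a b c ⟩
      quadrinomial a b c (c + 0)
        ≡⟨ quadrinomial-pascal a b c (c + 0) (≤-trans 1≤a+b+c (m≤m+n (a + b + c) (c + 0))) ⟩
      atPred a (λ a′ → quadrinomial a′ b c (c + 0)) + atPred b (λ b′ → quadrinomial a b′ c (c + 0))
        + atPred c (λ c′ → quadrinomial a b c′ (c + 0)) + atPred (c + 0) (quadrinomial a b c)
        ≡⟨ cong₂ _+_ (cong₂ _+_ (cong₂ _+_ (atPred-cong a (λ a′ _ → sym (wmvCoefficient-zero 0 a′ b c)))
                                           (atPred-cong b (λ b′ _ → sym (wmvCoefficient-zero 0 a b′ c))))
                                (atPred-cong c (λ c′ 1+c′≡c →
                                   trans (cong (quadrinomial a b c′) (c+0≡c′+1 c′ 1+c′≡c))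
                                                                    (sym (wmvCoefficient-zero 1 a b c′)))))
                     (trans (cong (λ v → atPred v (quadrinomial a b c)) (+-identityʳ c))
                            (atPred-cong c (λ c′ 1+c′≡c →
                               trans (swapped c′ 1+c′≡c) (sym (wmvCoefficient-zero 1 a b c′))))) ⟩
      atPred a (λ a′ → wmvCoefficient 0 0 a′ b c) + atPred b (λ b′ → wmvCoefficient 0 0 a b′ c)
        + atPred c (λ c′ → wmvCoefficient 0 1 a b c′) + atPred c (λ c′ → wmvCoefficient 0 1 a b c′) ∎
      where
      c+0≡c′+1 : ∀ c′ → suc c′ ≡ c → c + 0 ≡ c′ + 1
      c+0≡c′+1 c′ refl = trans (+-identityʳ (suc c′)) (+-comm 1 c′)
      swapped : ∀ c′ → suc c′ ≡ c → quadrinomial a b c c′ ≡ quadrinomial a b c′ (c′ + 1)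
      swapped c′ refl = trans (quadrinomial-swap a b (suc c′) c′) (cong (quadrinomial a b c′) (+-comm 1 c′))

  wmvCoefficient-base : ∀ a b c → wmvCoefficient 0 0 a b c ≡
    δ₀ a b c + atPred a (λ a′ → wmvCoefficient 0 0 a′ b c) + atPred b (λ b′ → wmvCoefficient 0 0 a b′ c)
      + atPred c (λ c′ → wmvCoefficient 0 1 a b c′) + atPred c (λ c′ → wmvCoefficient 0 1 a b c′)
  wmvCoefficient-base zero    zero    zero    = refl
  wmvCoefficient-base (suc a) b       c       = wmvCoefficient-base-positive (suc a) b c (s≤s z≤n)
  wmvCoefficient-base zero    (suc b) c       = wmvCoefficient-base-positive zero (suc b) c (s≤s z≤n)
  wmvCoefficient-base zero    zero    (suc c) = wmvCoefficient-base-positive zero zero (suc c) (s≤s z≤n)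

module NaturalRationals where

  open import Algebra.Bundles using (Ring)
  open import Data.Integer as ℤ using (+_)
  import Data.Integer.Properties as ℤ
  open import Data.Nat as ℕ using (ℕ; zero; suc; NonZero)
  import Data.Nat.Coprimality as Coprimality
  open import Data.Rational as ℚ using (ℚ; 0ℚ; 1ℚ; mkℚ)
  import Data.Rational.Properties as ℚ
  open import Algebra.Properties.Semiring.Mult (Ring.semiring ℚ.+-*-ring) using (_×_; ×-homo-+; ×1-homo-*)
  open import Relation.Binary.PropositionalEquality using (_≡_; refl; cong; cong₂; trans; sym)

  -- Opaque, so that an unknown v in fromℕ (v a b c) can be inferred by unification.
  opaque
    fromℕ : ℕ → ℚ
    fromℕ n = n × 1ℚ

  opaque
    unfolding fromℕ

    fromℕ-0 : fromℕ 0 ≡ 0ℚ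
    fromℕ-0 = refl

    fromℕ-1 : fromℕ 1 ≡ 1ℚ
    fromℕ-1 = refl

    fromℕ-+ : ∀ m n → fromℕ (m ℕ.+ n) ≡ fromℕ m ℚ.+ fromℕ n
    fromℕ-+ = ×-homo-+ 1ℚ

    fromℕ-* : ∀ m n → fromℕ (m ℕ.* n) ≡ fromℕ m ℚ.* fromℕ n
    fromℕ-* = ×1-homo-*

    private
      n/1 : ℕ → ℚ
      n/1 n = mkℚ (+ n) 0 (Coprimality.sym (Coprimality.1-coprimeTo n))

      fromℕ≡n/1 : ∀ n → fromℕ n ≡ n/1 n
      fromℕ≡n/1 zero    = refl
      fromℕ≡n/1 (suc n) = trans (cong (1ℚ ℚ.+_) (fromℕ≡n/1 n))
        (trans (cong (λ z → (+ 1 ℤ.+ z) ℚ./ 1) (ℤ.*-identityʳ (+ n))) (ℚ.↥p/↧p≡p (n/1 (suc n))))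

    fromℕ≡/1 : ∀ n → fromℕ n ≡ + n ℚ./ 1
    fromℕ≡/1 n = trans (fromℕ≡n/1 n) (sym (ℚ.↥p/↧p≡p (n/1 n)))

    1/n*fromℕ-n : ∀ n .{{_ : NonZero n}} → (+ 1 ℚ./ n) ℚ.* fromℕ n ≡ 1ℚ
    1/n*fromℕ-n (suc n) =
      trans (cong₂ ℚ._*_ (ℚ.↥p/↧p≡p (mkℚ (+ 1) n (Coprimality.1-coprimeTo (suc n)))) (fromℕ≡n/1 (suc n)))
            (ℚ.*-inverseˡ (n/1 (suc n)))

module ClosedForm where

  open import Defs
  open Shifts
  open Recurrences
  open Multinomials using (atPred)
  open WMVCoefficients
  open import Data.Bool using (true; false; if_then_else_)
  open import Data.Nat using (ℕ; zero; suc; _+_; _∸_; _≡ᵇ_)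
  open import Data.Nat.Properties using (+-suc)
  open import Data.Rational as ℚ using (ℚ; 0ℚ)
  open NaturalRationals
  open import Relation.Binary.PropositionalEquality using (_≡_; _≢_; refl; cong; cong₂; trans; sym)
  open import Data.Empty using (⊥-elim)
  open import Algebra.Bundles using (CommutativeRing)

  ifEq : ℕ → ℕ → ℚ → ℚ
  ifEq m s q = if m ≡ᵇ s then q else 0ℚ

  ifEq-self : ∀ m q → ifEq m m q ≡ q
  ifEq-self zero    q = refl
  ifEq-self (suc m) q = ifEq-self m q

  ifEq-≢ : ∀ m s q → m ≢ s → ifEq m s q ≡ 0ℚ
  ifEq-≢ zero    zero    q 0≢0   = ⊥-elim (0≢0 refl)
  ifEq-≢ zero    (suc s) q _     = refl
  ifEq-≢ (suc m) zero    q _     = refl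
  ifEq-≢ (suc m) (suc s) q m+1≢s+1 = ifEq-≢ m s q (λ m≡s → m+1≢s+1 (cong suc m≡s))

  ifEq-0 : ∀ m s → ifEq m s (fromℕ 0) ≡ 0ℚ
  ifEq-0 m s with m ≡ᵇ s
  ... | true  = fromℕ-0
  ... | false = refl

  ifEq-+ : ∀ m s p q → ifEq m s (p ℚ.+ q) ≡ ifEq m s p ℚ.+ ifEq m s q
  ifEq-+ m s p q with m ≡ᵇ s
  ... | true  = refl
  ... | false = refl

  -- The series Σ v a b c z^(a+b+2c) x^a y^b α^c; every W^k M^(L+1) V has this shape.
  balanced : (ℕ → ℕ → ℕ → ℕ) → Ser
  balanced v m a b c = ifEq m (a + b + (c + c)) (fromℕ (v a b c))

  balanced-cong : ∀ {v w} → (∀ a b c → v a b c ≡ w a b c) → balanced v ≈ balanced w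
  balanced-cong v≡w m a b c = cong (λ x → ifEq m _ (fromℕ x)) (v≡w a b c)

  ⊕-balanced : ∀ {F G v w} → F ≈ balanced v → G ≈ balanced w → F ⊕ G ≈ balanced (λ a b c → v a b c + w a b c)
  ⊕-balanced {v = v} {w} F≈v G≈w m a b c = trans (cong₂ ℚ._+_ (F≈v m a b c) (G≈w m a b c))
    (sym (trans (cong (ifEq m _) (fromℕ-+ (v a b c) (w a b c))) (ifEq-+ m _ _ _)))

  shiftXZ-balanced : ∀ v → shiftX (shiftZ (balanced v)) ≈ balanced (λ a b c → atPred a (λ a′ → v a′ b c))
  shiftXZ-balanced v m       zero    b c = sym (ifEq-0 m (b + (c + c)))
  shiftXZ-balanced v zero    (suc a) b c = refl
  shiftXZ-balanced v (suc m) (suc a) b c = refl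

  shiftYZ-balanced : ∀ v → shiftY (shiftZ (balanced v)) ≈ balanced (λ a b c → atPred b (λ b′ → v a b′ c))
  shiftYZ-balanced v m       a zero    c = sym (ifEq-0 m (a + 0 + (c + c)))
  shiftYZ-balanced v zero    a (suc b) c = cong (λ s → ifEq 0 s (fromℕ (v a b c))) (sym (cong (_+ (c + c)) (+-suc a b)))
  shiftYZ-balanced v (suc m) a (suc b) c = cong (λ s → ifEq (suc m) s (fromℕ (v a b c))) (sym (cong (_+ (c + c)) (+-suc a b)))

  private
    2+2c : ∀ a b c → a + b + (suc c + suc c) ≡ suc (suc (a + b + (c + c)))
    2+2c a b c = trans (cong (λ v → a + b + suc v) (+-suc c c))
                       (trans (+-suc (a + b) (suc (c + c))) (cong suc (+-suc (a + b) (c + c))))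

  shiftAZZ-balanced : ∀ v → shiftA (shiftZ (shiftZ (balanced v))) ≈ balanced (λ a b c → atPred c (λ c′ → v a b c′))
  shiftAZZ-balanced v m             a b zero    = sym (ifEq-0 m (a + b + 0))
  shiftAZZ-balanced v zero          a b (suc c) = cong (λ s → ifEq 0 s (fromℕ (v a b c))) (sym (2+2c a b c))
  shiftAZZ-balanced v (suc zero)    a b (suc c) = cong (λ s → ifEq 1 s (fromℕ (v a b c))) (sym (2+2c a b c))
  shiftAZZ-balanced v (suc (suc m)) a b (suc c) = cong (λ s → ifEq (suc (suc m)) s (fromℕ (v a b c))) (sym (2+2c a b c))

  𝟙-balanced : 𝟙 ≈ balanced δ₀
  𝟙-balanced zero    zero    zero    zero    = sym fromℕ-1
  𝟙-balanced (suc m) zero    zero    zero    = refl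
  𝟙-balanced zero    zero    zero    (suc c) = sym (ifEq-0 0 (suc c + suc c))
  𝟙-balanced (suc m) zero    zero    (suc c) = sym (ifEq-0 (suc m) (suc c + suc c))
  𝟙-balanced zero    zero    (suc b) c       = sym (ifEq-0 0 (suc b + (c + c)))
  𝟙-balanced (suc m) zero    (suc b) c       = sym (ifEq-0 (suc m) (suc b + (c + c)))
  𝟙-balanced zero    (suc a) b       c       = sym (ifEq-0 0 (suc a + b + (c + c)))
  𝟙-balanced (suc m) (suc a) b       c       = sym (ifEq-0 (suc m) (suc a + b + (c + c)))

  closedForm : ℕ → ℕ → Ser
  closedForm k L = balanced (wmvCoefficient k L)

  shiftedClosedForm : (f t j : ℕ) → Ser
  shiftedClosedForm f t j = shiftZ^ (f + t + 2) (shiftA^ (f + 1) (closedForm (f ∸ j) (t + j + 1)))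

  closedForm-WMVRecurrence : WMVRecurrence closedForm
  closedForm-WMVRecurrence = record
    { step-k = λ k L → S.trans (balanced-cong (wmvCoefficient-suc-k k L))
        (S.sym (⊕-balanced S.refl (shiftYZ-balanced (wmvCoefficient (suc k) L))))
    ; step-L = λ L → S.trans (balanced-cong (wmvCoefficient-suc-L L))
        (S.sym (⊕-balanced (⊕-balanced (⊕-balanced S.refl
          (shiftXZ-balanced (wmvCoefficient 0 (suc L)))) (shiftYZ-balanced (wmvCoefficient 0 (suc L))))
          (shiftAZZ-balanced (wmvCoefficient 0 (suc (suc L))))))
    ; base = S.trans (balanced-cong wmvCoefficient-base)
        (S.sym (⊕-balanced (⊕-balanced (⊕-balanced (⊕-balanced 𝟙-balanced
          (shiftXZ-balanced (wmvCoefficient 0 0))) (shiftYZ-balanced (wmvCoefficient 0 0)))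
          (shiftAZZ-balanced (wmvCoefficient 0 1))) (shiftAZZ-balanced (wmvCoefficient 0 1))))
    }
    where
    module S = CommutativeRing SeriesRing.Series

module MWV where

  open import Defs using (Ser; _≈_; Xs; Ys; Zs; As)
  open Algebra.Bundles.CommutativeRing SeriesRing.Series using (_+_; _*_; _-_; 1#; semiring)
  open Algebra.Properties.Semiring.Exp semiring using (_^_)

  record FunctionalEquations (M W V : Ser) : Set where
    field
      M-eq  : M ≈ 1# + (Xs + Ys) * Zs * M + As * Zs ^ 2 * M ^ 2
      W-inv : W * (1# - Ys * Zs) ≈ 1#
      V-inv : V * (1# - As * Zs ^ 2 * M ^ 2) ≈ 1#

module GeneratingFunctions (M W V : Defs.Ser) (equations : MWV.FunctionalEquations M W V) where

  open MWV.FunctionalEquations equations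
  open import Defs using (Ser; _≈_; Xs; Ys; Zs; As)
  open import Data.Integer using (+_)
  open import Data.Nat as ℕ using (ℕ; suc; _∸_; _<_)
  open import Data.Nat.Properties using (<⇒≤; ≤-trans; +-∸-assoc; m∸n+n≡m)
  open import Data.Nat.Tactic.RingSolver using (solve-∀)
  open import Relation.Binary.PropositionalEquality as ≡ using (_≡_)
  open import Algebra.Bundles using (CommutativeRing)
  open SeriesRing using (Series; +≈⊕-cong; 1≈𝟙; -‿coefficient; sumBelow-coefficient)
  open CommutativeRing Series hiding (_≈_)
  open import Algebra.Properties.Semiring.Exp semiring using (_^_; ^-homo-*; ^-congʳ)
  open import Algebra.Properties.CommutativeSemiring.Exp commutativeSemiring using (^-distrib-*)
  open IntegerCoefficientSolver Series using (solve; _:+_; _:*_; :-_; _:-_; con; _:=_; _:^_)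
  open import Relation.Binary.Reasoning.Setoid setoid
  open Shifts
  open Recurrences
  open ClosedForm using (closedForm; closedForm-WMVRecurrence; shiftedClosedForm)
  open GeometricSums Series using (geometric; *-geometric)
  open FiniteSums commutativeSemiring using (sumBelow; *-distribˡ-sumBelow; *-distribʳ-sumBelow)
  import Data.Rational as ℚ
  private module ℚΣ = FiniteSums (CommutativeRing.commutativeSemiring SeriesRing.ℚ-ring)

  W-unfold : W ≈ 1# + Ys * (Zs * W)
  W-unfold = begin
    W                                       ≈⟨ *-identityʳ W ⟨
    W * 1#                                  ≈⟨ split 1# W Ys Zs ⟩
    W * (1# - Ys * Zs) + Ys * (Zs * W)      ≈⟨ +-congʳ W-inv ⟩
    1# + Ys * (Zs * W)                      ∎
    where
    split : ∀ o w y z → w * o ≈ w * (o - y * z) + y * (z * w)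
    split = solve 4 (λ o w y z → w :* o := w :* (o :- y :* z) :+ y :* (z :* w)) refl

  V-unfold : V ≈ 1# + V * (As * Zs ^ 2 * M ^ 2)
  V-unfold = begin
    V                                       ≈⟨ *-identityʳ V ⟨
    V * 1#                                  ≈⟨ split 1# V (As * Zs ^ 2 * M ^ 2) ⟩
    V * (1# - As * Zs ^ 2 * M ^ 2) + V * (As * Zs ^ 2 * M ^ 2) ≈⟨ +-congʳ V-inv ⟩
    1# + V * (As * Zs ^ 2 * M ^ 2)          ∎
    where
    split : ∀ o v p → v * o ≈ v * (o - p) + v * p
    split = solve 3 (λ o v p → v :* o := v :* (o :- p) :+ v :* p) refl

  H : ℕ → ℕ → Ser
  H k L = W ^ k * (M ^ suc L * V)

  H-step-k : ∀ k L → H (suc k) L ≈ H k L + Ys * (Zs * H (suc k) L)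
  H-step-k k L = begin
    (W * W ^ k) * R                         ≈⟨ *-congʳ (*-congʳ W-unfold) ⟩
    ((1# + Ys * (Zs * W)) * W ^ k) * R      ≈⟨ expand W (W ^ k) R Ys Zs ⟩
    W ^ k * R + Ys * (Zs * ((W * W ^ k) * R)) ∎
    where
    R = M ^ suc L * V
    expand : ∀ w wk r y z → ((1# + y * (z * w)) * wk) * r ≈ wk * r + y * (z * ((w * wk) * r))
    expand = solve 5 (λ w wk r y z →
      ((con (+ 1) :+ y :* (z :* w)) :* wk) :* r := wk :* r :+ y :* (z :* ((w :* wk) :* r))) refl

  H-step-L : ∀ L → H 0 (suc L) ≈
    H 0 L + Xs * (Zs * H 0 (suc L)) + Ys * (Zs * H 0 (suc L)) + As * (Zs * (Zs * H 0 (suc (suc L))))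
  H-step-L L = begin
    1# * ((M * Mᴸ) * V)
      ≈⟨ *-congˡ (*-congʳ (*-congʳ M-eq)) ⟩
    1# * (((1# + (Xs + Ys) * Zs * M + As * Zs ^ 2 * M ^ 2) * Mᴸ) * V)
      ≈⟨ expand M Mᴸ V Xs Ys Zs As ⟩
    1# * (Mᴸ * V) + Xs * (Zs * (1# * ((M * Mᴸ) * V))) + Ys * (Zs * (1# * ((M * Mᴸ) * V)))
      + As * (Zs * (Zs * (1# * ((M * (M * Mᴸ)) * V)))) ∎
    where
    Mᴸ = M ^ suc L
    expand : ∀ m mᴸ v x y z a → 1# * (((1# + (x + y) * z * m + a * z ^ 2 * m ^ 2) * mᴸ) * v) ≈
      1# * (mᴸ * v) + x * (z * (1# * ((m * mᴸ) * v))) + y * (z * (1# * ((m * mᴸ) * v)))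
        + a * (z * (z * (1# * ((m * (m * mᴸ)) * v))))
    expand = solve 7 (λ m mᴸ v x y z a →
      con (+ 1) :* (((con (+ 1) :+ (x :+ y) :* z :* m :+ a :* z :^ 2 :* m :^ 2) :* mᴸ) :* v) :=
      con (+ 1) :* (mᴸ :* v) :+ x :* (z :* (con (+ 1) :* ((m :* mᴸ) :* v))) :+ y :* (z :* (con (+ 1) :* ((m :* mᴸ) :* v)))
        :+ a :* (z :* (z :* (con (+ 1) :* ((m :* (m :* mᴸ)) :* v))))) refl

  H-base : H 0 0 ≈ 1# + Xs * (Zs * H 0 0) + Ys * (Zs * H 0 0) + As * (Zs * (Zs * H 0 1)) + As * (Zs * (Zs * H 0 1))
  H-base = begin
    1# * ((M * 1#) * V)
      ≈⟨ *-congˡ (*-congʳ (*-congʳ M-eq)) ⟩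
    1# * (((1# + (Xs + Ys) * Zs * M + As * Zs ^ 2 * M ^ 2) * 1#) * V)
      ≈⟨ expand M V Xs Ys Zs As ⟩
    V + X + Y + A
      ≈⟨ +-congʳ (+-congʳ (+-congʳ V-unfold)) ⟩
    1# + V * (As * Zs ^ 2 * M ^ 2) + X + Y + A
      ≈⟨ +-congʳ (+-congʳ (+-congʳ (+-congˡ (commute M V Zs As)))) ⟩
    1# + A + X + Y + A
      ≈⟨ move 1# A X Y ⟩
    1# + X + Y + A + A ∎
    where
    X = Xs * (Zs * H 0 0)
    Y = Ys * (Zs * H 0 0)
    A = As * (Zs * (Zs * H 0 1))
    expand : ∀ m v x y z a → 1# * (((1# + (x + y) * z * m + a * z ^ 2 * m ^ 2) * 1#) * v) ≈
      v + x * (z * (1# * ((m * 1#) * v))) + y * (z * (1# * ((m * 1#) * v))) + a * (z * (z * (1# * ((m * (m * 1#)) * v))))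
    expand = solve 6 (λ m v x y z a →
      con (+ 1) :* (((con (+ 1) :+ (x :+ y) :* z :* m :+ a :* z :^ 2 :* m :^ 2) :* con (+ 1)) :* v) :=
      v :+ x :* (z :* (con (+ 1) :* ((m :* con (+ 1)) :* v))) :+ y :* (z :* (con (+ 1) :* ((m :* con (+ 1)) :* v)))
        :+ a :* (z :* (z :* (con (+ 1) :* ((m :* (m :* con (+ 1))) :* v))))) refl
    commute : ∀ m v z a → v * (a * z ^ 2 * m ^ 2) ≈ a * (z * (z * (1# * ((m * (m * 1#)) * v))))
    commute = solve 4 (λ m v z a →
      v :* (a :* z :^ 2 :* m :^ 2) := a :* (z :* (z :* (con (+ 1) :* ((m :* (m :* con (+ 1))) :* v))))) refl
    move : ∀ o a x y → o + a + x + y + a ≈ o + x + y + a + a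
    move = solve 4 (λ o a x y → o :+ a :+ x :+ y :+ a := o :+ x :+ y :+ a :+ a) refl

  private
    XZ : ∀ F → Xs * (Zs * F) ≈ shiftX (shiftZ F)
    XZ F = trans (Xs*≈shiftX _) (shiftX-cong (Zs*≈shiftZ F))

    YZ : ∀ F → Ys * (Zs * F) ≈ shiftY (shiftZ F)
    YZ F = trans (Ys*≈shiftY _) (shiftY-cong (Zs*≈shiftZ F))

    AZZ : ∀ F → As * (Zs * (Zs * F)) ≈ shiftA (shiftZ (shiftZ F))
    AZZ F = trans (As*≈shiftA _) (shiftA-cong (trans (Zs*≈shiftZ _) (shiftZ-cong (Zs*≈shiftZ F))))

  H-WMVRecurrence : WMVRecurrence H
  H-WMVRecurrence = record
    { step-k = λ k L → trans (H-step-k k L) (+≈⊕-cong refl (YZ _))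
    ; step-L = λ L → trans (H-step-L L) (+≈⊕-cong (+≈⊕-cong (+≈⊕-cong refl (XZ _)) (YZ _)) (AZZ _))
    ; base   = trans H-base (+≈⊕-cong (+≈⊕-cong (+≈⊕-cong (+≈⊕-cong 1≈𝟙 (XZ _)) (YZ _)) (AZZ _)) (AZZ _))
    }

  H≈closedForm : ∀ k L → H k L ≈ closedForm k L
  H≈closedForm = WMVRecurrence-unique H-WMVRecurrence closedForm-WMVRecurrence

  a b D : Ser
  a = Zs * W
  b = Zs * M
  D = Xs + As * Zs * M

  M≈W+WzMD : M ≈ W + W * Zs * M * D
  M≈W+WzMD = begin
    M                                         ≈⟨ *-identityʳ M ⟨
    M * 1#                                    ≈⟨ *-congˡ W-inv ⟨
    M * (W * (1# - Ys * Zs))                  ≈⟨ factor M W Ys Zs ⟩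
    W * (M - Ys * Zs * M)                     ≈⟨ *-congˡ (+-congʳ M-eq) ⟩
    W * (1# + (Xs + Ys) * Zs * M + As * Zs ^ 2 * M ^ 2 - Ys * Zs * M) ≈⟨ collect W M Xs Ys Zs As ⟩
    W + W * Zs * M * D                        ∎
    where
    factor : ∀ m w y z → m * (w * (1# - y * z)) ≈ w * (m - y * z * m)
    factor = solve 4 (λ m w y z → m :* (w :* (con (+ 1) :- y :* z)) := w :* (m :- y :* z :* m)) refl
    collect : ∀ w m x y z a →
      w * (1# + (x + y) * z * m + a * z ^ 2 * m ^ 2 - y * z * m) ≈ w + w * z * m * (x + a * z * m)
    collect = solve 6 (λ w m x y z a →
      w :* (con (+ 1) :+ (x :+ y) :* z :* m :+ a :* z :^ 2 :* m :^ 2 :- y :* z :* m) :=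
      w :+ w :* z :* m :* (x :+ a :* z :* m)) refl

  a*b*D≈b-a : a * b * D ≈ b - a
  a*b*D≈b-a = begin
    a * b * D                                 ≈⟨ expand Zs W M D ⟨
    Zs * (W + W * Zs * M * D) - Zs * W        ≈⟨ +-congʳ (*-congˡ M≈W+WzMD) ⟨
    b - a                                     ∎
    where
    expand : ∀ z w m d → z * (w + w * z * m * d) - z * w ≈ (z * w) * (z * m) * d
    expand = solve 4 (λ z w m d → z :* (w :+ w :* z :* m :* d) :- z :* w := (z :* w) :* (z :* m) :* d) refl

  Q₀ : ℕ → Ser
  Q₀ t = - geometric a b t

  Q₀*D : ∀ t → Q₀ t * D ≈ a ^ t - b ^ t
  Q₀*D t = begin
    - geometric a b t * D          ≈⟨ -‿distribˡ-* (geometric a b t) D ⟨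
    - (geometric a b t * D)        ≈⟨ -‿cong (*-comm _ D) ⟩
    - (D * geometric a b t)        ≈⟨ -‿cong (*-geometric a b D a*b*D≈b-a t) ⟩
    - (b ^ t - a ^ t)              ≈⟨ ⁻¹-anti-homo‿- (b ^ t) (a ^ t) ⟩
    a ^ t - b ^ t                  ∎
    where open import Algebra.Properties.Ring ring using (-‿distribˡ-*; ⁻¹-anti-homo‿-)

  D-cancellative : ∀ G → G * D ≈ 0# → G ≈ 0#
  D-cancellative G GD≈0 = x+zF-cancellative (As * M) G (trans (*-congˡ (D≈x+zαM)) GD≈0)
    where
    D≈x+zαM : Xs + Zs * (As * M) ≈ D
    D≈x+zαM = solve 4 (λ x z a m → x :+ z :* (a :* m) := x :+ a :* z :* m) refl Xs Zs As M

  Q-unique : ∀ t Q → Q * D ≈ a ^ t - b ^ t → Q ≈ Q₀ t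
  Q-unique t Q QD≈aᵗ-bᵗ = x∙y⁻¹≈ε⇒x≈y Q (Q₀ t) (D-cancellative (Q - Q₀ t) (begin
    (Q - Q₀ t) * D                 ≈⟨ distrib-minus Q (Q₀ t) D ⟩
    Q * D - Q₀ t * D               ≈⟨ +-cong QD≈aᵗ-bᵗ (-‿cong (Q₀*D t)) ⟩
    (a ^ t - b ^ t) - (a ^ t - b ^ t) ≈⟨ -‿inverseʳ _ ⟩
    0#                             ∎))
    where
    open import Algebra.Properties.Group +-group using (x∙y⁻¹≈ε⇒x≈y)
    distrib-minus : ∀ q r d → (q - r) * d ≈ q * d - r * d
    distrib-minus = solve 3 (λ q r d → (q :- r) :* d := q :* d :- r :* d) refl

  module _ (f t : ℕ) (t<f : t < f) where

    private
      Aᶠ : Ser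
      Aᶠ = As ^ (f ℕ.+ 1)

      term : ℕ → Ser
      term j = Aᶠ * a ^ (f ∸ t) * (b ^ suc j * a ^ (t ∸ j)) * b ^ (t ℕ.+ 1) * V

    lhs : Ser → Ser
    lhs Q = Aᶠ * a ^ (f ∸ t) * Q * b ^ (t ℕ.+ 1) * V

    lhs-Q₀ : lhs (Q₀ t) ≈ - sumBelow t term
    lhs-Q₀ = begin
      P * (- sumBelow t g) * B * V       ≈⟨ pull-minus P (sumBelow t g) B V ⟩
      - (P * sumBelow t g * B * V)       ≈⟨ -‿cong (*-congʳ (*-congʳ (*-distribˡ-sumBelow t P g))) ⟩
      - (sumBelow t (λ j → P * g j) * B * V) ≈⟨ -‿cong (*-congʳ (*-distribʳ-sumBelow t B _)) ⟩
      - (sumBelow t (λ j → P * g j * B) * V) ≈⟨ -‿cong (*-distribʳ-sumBelow t V _) ⟩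
      - sumBelow t term                  ∎
      where
      P = Aᶠ * a ^ (f ∸ t)
      B = b ^ (t ℕ.+ 1)
      g : ℕ → Ser
      g j = b ^ suc j * a ^ (t ∸ j)
      pull-minus : ∀ p s r v → p * (- s) * r * v ≈ - (p * s * r * v)
      pull-minus = solve 4 (λ p s r v → p :* (:- s) :* r :* v := :- (p :* s :* r :* v)) refl

    private
      f∸t+t∸j≡f∸j : ∀ {j} → j < t → (f ∸ t) ℕ.+ (t ∸ j) ≡ f ∸ j
      f∸t+t∸j≡f∸j {j} j<t = ≡.trans (≡.sym (+-∸-assoc (f ∸ t) (<⇒≤ j<t))) (≡.cong (_∸ j) (m∸n+n≡m (<⇒≤ t<f)))

      exponent-M : ∀ j → suc j ℕ.+ (t ℕ.+ 1) ≡ suc (t ℕ.+ j ℕ.+ 1)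
      exponent-M j = swap j t
        where
        swap : ∀ j t → suc j ℕ.+ (t ℕ.+ 1) ≡ suc (t ℕ.+ j ℕ.+ 1)
        swap = solve-∀

      exponent-Z : ∀ {j} → j < t → (f ∸ t) ℕ.+ (t ∸ j) ℕ.+ (suc j ℕ.+ (t ℕ.+ 1)) ≡ f ℕ.+ t ℕ.+ 2
      exponent-Z {j} j<t = ≡.trans (≡.cong (ℕ._+ (suc j ℕ.+ (t ℕ.+ 1))) (f∸t+t∸j≡f∸j j<t))
                         (≡.trans (regroup (f ∸ j) j t)
                                  (≡.cong (λ x → x ℕ.+ t ℕ.+ 2) (m∸n+n≡m (≤-trans (<⇒≤ j<t) (<⇒≤ t<f)))))
        where
        regroup : ∀ x j t → x ℕ.+ (suc j ℕ.+ (t ℕ.+ 1)) ≡ x ℕ.+ j ℕ.+ t ℕ.+ 2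
        regroup = solve-∀

    term≈z^α^H : ∀ j → j < t → term j ≈ Zs ^ (f ℕ.+ t ℕ.+ 2) * (Aᶠ * H (f ∸ j) (t ℕ.+ j ℕ.+ 1))
    term≈z^α^H j j<t = begin
      Aᶠ * a ^ (f ∸ t) * (b ^ suc j * a ^ (t ∸ j)) * b ^ (t ℕ.+ 1) * V
        ≈⟨ *-congʳ (*-cong (*-cong (*-congˡ (^-distrib-* Zs W (f ∸ t)))
                                    (*-cong (^-distrib-* Zs M (suc j)) (^-distrib-* Zs W (t ∸ j))))
                            (^-distrib-* Zs M (t ℕ.+ 1))) ⟩
      Aᶠ * (z₁ * w₁) * ((z₂ * m₂) * (z₃ * w₃)) * (z₄ * m₄) * V
        ≈⟨ regroup Aᶠ z₁ w₁ z₂ m₂ z₃ w₃ z₄ m₄ V ⟩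
      (z₁ * z₃) * (z₂ * z₄) * (Aᶠ * ((w₁ * w₃) * ((m₂ * m₄) * V)))
        ≈⟨ *-cong (*-cong (^-homo-* Zs (f ∸ t) (t ∸ j)) (^-homo-* Zs (suc j) (t ℕ.+ 1)))
                  (*-congˡ (*-cong (^-homo-* W (f ∸ t) (t ∸ j)) (*-congʳ (^-homo-* M (suc j) (t ℕ.+ 1))))) ⟨
      Zs ^ ((f ∸ t) ℕ.+ (t ∸ j)) * Zs ^ (suc j ℕ.+ (t ℕ.+ 1))
        * (Aᶠ * (W ^ ((f ∸ t) ℕ.+ (t ∸ j)) * (M ^ (suc j ℕ.+ (t ℕ.+ 1)) * V)))
        ≈⟨ *-cong (^-homo-* Zs ((f ∸ t) ℕ.+ (t ∸ j)) (suc j ℕ.+ (t ℕ.+ 1)))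
                  (*-congˡ (*-cong (^-congʳ W (≡.sym (f∸t+t∸j≡f∸j j<t))) (*-congʳ (^-congʳ M (≡.sym (exponent-M j)))))) ⟨
      Zs ^ ((f ∸ t) ℕ.+ (t ∸ j) ℕ.+ (suc j ℕ.+ (t ℕ.+ 1))) * (Aᶠ * H (f ∸ j) (t ℕ.+ j ℕ.+ 1))
        ≈⟨ *-congʳ (^-congʳ Zs (exponent-Z j<t)) ⟩
      Zs ^ (f ℕ.+ t ℕ.+ 2) * (Aᶠ * H (f ∸ j) (t ℕ.+ j ℕ.+ 1)) ∎
      where
      z₁ = Zs ^ (f ∸ t)
      w₁ = W ^ (f ∸ t)
      z₂ = Zs ^ suc j
      m₂ = M ^ suc j
      z₃ = Zs ^ (t ∸ j)
      w₃ = W ^ (t ∸ j)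
      z₄ = Zs ^ (t ℕ.+ 1)
      m₄ = M ^ (t ℕ.+ 1)
      regroup : ∀ p z₁ w₁ z₂ m₂ z₃ w₃ z₄ m₄ v →
        p * (z₁ * w₁) * ((z₂ * m₂) * (z₃ * w₃)) * (z₄ * m₄) * v ≈ (z₁ * z₃) * (z₂ * z₄) * (p * ((w₁ * w₃) * ((m₂ * m₄) * v)))
      regroup = solve 10 (λ p z₁ w₁ z₂ m₂ z₃ w₃ z₄ m₄ v →
        p :* (z₁ :* w₁) :* ((z₂ :* m₂) :* (z₃ :* w₃)) :* (z₄ :* m₄) :* v :=
        (z₁ :* z₃) :* (z₂ :* z₄) :* (p :* ((w₁ :* w₃) :* ((m₂ :* m₄) :* v)))) refl

    term≈shiftedClosedForm : ∀ j → j < t → term j ≈ shiftedClosedForm f t j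
    term≈shiftedClosedForm j j<t =
      trans (term≈z^α^H j j<t) (trans (Zs^*≈shiftZ^ (f ℕ.+ t ℕ.+ 2) _) (shiftZ^-cong (f ℕ.+ t ℕ.+ 2)
        (trans (As^*≈shiftA^ (f ℕ.+ 1) _) (shiftA^-cong (f ℕ.+ 1) (H≈closedForm (f ∸ j) (t ℕ.+ j ℕ.+ 1))))))

    lhs-coefficient : ∀ Q → Q * D ≈ a ^ t - b ^ t → ∀ n c d e →
      lhs Q n c d e ≡ ℚ.- ℚΣ.sumBelow t (λ j → shiftedClosedForm f t j n c d e)
    lhs-coefficient Q QD≈aᵗ-bᵗ n c d e =
      ≡.trans (lhs≈-sum n c d e) (≡.trans (-‿coefficient (sumBelow t term) n c d e) (≡.cong ℚ.-_
        (≡.trans (sumBelow-coefficient t term n c d e)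
                 (ℚΣ.sumBelow-cong t (λ j j<t → term≈shiftedClosedForm j j<t n c d e)))))
      where
      lhs≈-sum : lhs Q ≈ - sumBelow t term
      lhs≈-sum = trans (*-congʳ (*-congʳ (*-congˡ (Q-unique t Q QD≈aᵗ-bᵗ)))) lhs-Q₀

module RightHandSide where

  open import Defs using (rhsTerm; fct; invFct; recip; ι)
  open Multinomials
  open NaturalRationals
  open import Data.Integer as ℤ using (ℤ; +_; -[1+_])
  import Data.Integer.Properties as ℤ
  open import Data.Integer.Tactic.RingSolver using () renaming (solve-∀ to ℤ-solve-∀)
  open import Data.Nat as ℕ using (ℕ; suc; _+_; _*_; _!)
  open import Data.Nat.Properties using (+-comm; _!≢0; +-*-commutativeSemiring)
  open import Data.Nat.Tactic.RingSolver using (solve-∀)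
  open import Data.Rational as ℚ using (ℚ; 0ℚ; 1ℚ)
  import Data.Rational.Properties as ℚ
  open import Relation.Binary.PropositionalEquality using (_≡_; refl; cong; cong₂; trans; sym; module ≡-Reasoning)
  open import Data.Maybe using (Maybe; just; nothing)
  open import Relation.Nullary using (yes; no)
  open import Tactic.RingSolver.Core.AlmostCommutativeRing using (AlmostCommutativeRing; fromCommutativeRing)
  open import Tactic.RingSolver using () renaming (solve-∀ to ring-solve-∀)
  open FiniteSums +-*-commutativeSemiring using (sumBelow)

  -- rhsTerm as a function of its eight integer factorial arguments; opaque, so that these
  -- can be inferred by unification.
  opaque
    rhsShape : (c d : ℕ) (z₁ z₂ z₃ z₄ z₅ z₆ z₇ z₈ : ℤ) → ℚ
    rhsShape c d z₁ z₂ z₃ z₄ z₅ z₆ z₇ z₈ =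
      fct z₁ ℚ.* fct z₂ ℚ.* recip z₃ ℚ.* invFct (+ c) ℚ.* invFct (+ d) ℚ.* invFct z₄ ℚ.* invFct z₅
        ℚ.* invFct z₆ ℚ.-
      fct z₁ ℚ.* fct z₇ ℚ.* recip z₃ ℚ.* invFct (+ c) ℚ.* invFct (+ d) ℚ.* invFct z₄ ℚ.* invFct z₈
        ℚ.* invFct z₆

  opaque
    unfolding rhsShape

    rhsTerm≡rhsShape : ∀ n f t c d e {z₁ z₂ z₃ z₄ z₅ z₆ z₇ z₈} →
      ι n ℤ.- ι 1 ≡ z₁ → ι n ℤ.- ι d ℤ.- ι f ℤ.- ι 1 ≡ z₂ → ι c ℤ.+ ι e ℤ.- ι f ≡ z₃ →
      ι n ℤ.- ι d ℤ.- ι 1 ≡ z₄ → ι e ℤ.- ι f ℤ.+ ι t ℤ.- ι 1 ≡ z₅ → ι e ℤ.- ι f ℤ.- ι 1 ≡ z₆ →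
      ι n ℤ.- ι d ℤ.- ι f ℤ.+ ι t ℤ.- ι 1 ≡ z₇ → ι e ℤ.- ι f ℤ.+ ι 2 ℤ.* ι t ℤ.- ι 1 ≡ z₈ →
      rhsTerm n f t c d e ≡ rhsShape c d z₁ z₂ z₃ z₄ z₅ z₆ z₇ z₈
    rhsTerm≡rhsShape n f t c d e refl refl refl refl refl refl refl refl = refl

    rhsShape-negative : ∀ c d z₁ z₂ z₃ z₄ z₅ u z₇ z₈ →
      rhsShape c d z₁ z₂ z₃ z₄ z₅ -[1+ u ] z₇ z₈ ≡ 0ℚ
    rhsShape-negative c d z₁ z₂ z₃ z₄ z₅ u z₇ z₈ = cong₂ ℚ._-_
      (ℚ.*-zeroʳ (fct z₁ ℚ.* fct z₂ ℚ.* recip z₃ ℚ.* invFct (+ c) ℚ.* invFct (+ d) ℚ.* invFct z₄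
                    ℚ.* invFct z₅))
      (ℚ.*-zeroʳ (fct z₁ ℚ.* fct z₇ ℚ.* recip z₃ ℚ.* invFct (+ c) ℚ.* invFct (+ d) ℚ.* invFct z₄
                    ℚ.* invFct z₈))

  ι-minus : ∀ {x} k y → x ≡ k + y → ι x ℤ.- ι y ≡ ι k
  ι-minus k y refl = trans (cong (ℤ._- ι y) (ℤ.pos-+ k y)) (cancel (ι k) (ι y))
    where
    cancel : ∀ a b → a ℤ.+ b ℤ.- b ≡ a
    cancel = ℤ-solve-∀

  rhsTerm-vanishes : ∀ n e u t c d → rhsTerm n (e + u) t c d e ≡ 0ℚ
  rhsTerm-vanishes n e u t c d =
    trans (rhsTerm≡rhsShape n (e + u) t c d e refl refl refl refl refl e-[e+u]-1≡-[1+u] refl refl)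
          (rhsShape-negative c d _ _ _ _ _ u _ _)
    where
    e-[e+u]-1≡-[1+u] : ι e ℤ.- ι (e + u) ℤ.- ι 1 ≡ -[1+ u ]
    e-[e+u]-1≡-[1+u] = trans (cong (λ z → ι e ℤ.- z ℤ.- ι 1) (ℤ.pos-+ e u))
                         (trans (negate (ι e) (ι u)) (cong ℤ.-_ (trans (sym (ℤ.pos-+ u 1)) (cong +_ (+-comm u 1)))))
      where
      negate : ∀ a b → a ℤ.- (a ℤ.+ b) ℤ.- ℤ.+ 1 ≡ ℤ.- (b ℤ.+ ℤ.+ 1)
      negate = ℤ-solve-∀

  private
    ℚ-almostCommutativeRing : AlmostCommutativeRing _ _
    ℚ-almostCommutativeRing = fromCommutativeRing ℚ.+-*-commutativeRing is-zero
      where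
      is-zero : ∀ x → Maybe (0ℚ ≡ x)
      is-zero x with 0ℚ ℚ.≟ x
      ... | yes 0≡x = just 0≡x
      ... | no  _   = nothing

  fct≡fromℕ! : ∀ k → fct (+ k) ≡ fromℕ (k !)
  fct≡fromℕ! k = sym (fromℕ≡/1 (k !))

  invFct*fromℕ! : ∀ k → invFct (+ k) ℚ.* fromℕ (k !) ≡ 1ℚ
  invFct*fromℕ! k = 1/n*fromℕ-n (k !) {{k !≢0}}

  trinomial-!-suc : ∀ a c r → (a + c + suc r) ! ≡ (trinomial a c (suc r) * suc r) * (a ! * c ! * r !)
  trinomial-!-suc a c r = sym (trans (regroup (trinomial a c (suc r)) (suc r) (a !) (c !) (r !)) (trinomial-! a c (suc r)))
    where
    regroup : ∀ μ R x y z → μ * R * (x * y * z) ≡ μ * (x * y * (R * z))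
    regroup = solve-∀

  -- Here n - 1 = N, n - d - f - 1 = A, n - d - 1 = K, e - f + t - 1 = r, n - d - f + t - 1 = A′
  -- and e - f + 2t - 1 = r + t.
  module OnSupport (c d e′ f t : ℕ) where

    m n e N K r R A A′ : ℕ
    m  = c + d + (e′ + e′)
    n  = f + t + 2 + m
    e  = f + 1 + e′
    N  = f + t + 1 + m
    K  = c + (e′ + e′) + f + t + 1
    r  = e′ + t
    R  = suc r
    A  = c + e′ + R
    A′ = c + e′ + (R + t)

    B S : ℕ
    B = binomial d K
    S = sumBelow t (λ j → trinomial c e′ (R + j))

    private
      z₁ : ι n ℤ.- ι 1 ≡ ι N
      z₁ = ι-minus N 1 (shift c d e′ f t)
        where
        shift : ∀ c d e′ f t → f + t + 2 + (c + d + (e′ + e′)) ≡ f + t + 1 + (c + d + (e′ + e′)) + 1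
        shift = solve-∀

      n-d≡A+1+f : n ≡ A + 1 + f + d
      n-d≡A+1+f = shift c d e′ f t
        where
        shift : ∀ c d e′ f t → f + t + 2 + (c + d + (e′ + e′)) ≡ c + e′ + suc (e′ + t) + 1 + f + d
        shift = solve-∀

      z₂ : ι n ℤ.- ι d ℤ.- ι f ℤ.- ι 1 ≡ ι A
      z₂ = trans (cong (λ z → z ℤ.- ι f ℤ.- ι 1) (ι-minus (A + 1 + f) d n-d≡A+1+f))
                 (trans (cong (ℤ._- ι 1) (ι-minus (A + 1) f refl)) (ι-minus A 1 refl))

      z₃ : ι c ℤ.+ ι e ℤ.- ι f ≡ ι (suc (c + e′))
      z₃ = trans (cong (ℤ._- ι f) (sym (ℤ.pos-+ c e))) (ι-minus (suc (c + e′)) f (shift c e′ f))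
        where
        shift : ∀ c e′ f → c + (f + 1 + e′) ≡ suc (c + e′) + f
        shift = solve-∀

      z₄ : ι n ℤ.- ι d ℤ.- ι 1 ≡ ι K
      z₄ = trans (cong (ℤ._- ι 1) (ι-minus (K + 1) d (shift c d e′ f t))) (ι-minus K 1 refl)
        where
        shift : ∀ c d e′ f t → f + t + 2 + (c + d + (e′ + e′)) ≡ c + (e′ + e′) + f + t + 1 + 1 + d
        shift = solve-∀

      e-f : ι e ℤ.- ι f ≡ ι (1 + e′)
      e-f = ι-minus (1 + e′) f (shift e′ f)
        where
        shift : ∀ e′ f → f + 1 + e′ ≡ 1 + e′ + f
        shift = solve-∀

      z₅ : ι e ℤ.- ι f ℤ.+ ι t ℤ.- ι 1 ≡ ι r
      z₅ = trans (cong (λ z → z ℤ.+ ι t ℤ.- ι 1) e-f)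
                 (trans (cong (ℤ._- ι 1) (sym (ℤ.pos-+ (1 + e′) t))) (ι-minus r 1 (shift e′ t)))
        where
        shift : ∀ e′ t → 1 + e′ + t ≡ e′ + t + 1
        shift = solve-∀

      z₆ : ι e ℤ.- ι f ℤ.- ι 1 ≡ ι e′
      z₆ = trans (cong (ℤ._- ι 1) e-f) (ι-minus e′ 1 (+-comm 1 e′))

      z₇ : ι n ℤ.- ι d ℤ.- ι f ℤ.+ ι t ℤ.- ι 1 ≡ ι A′
      z₇ = trans (cong (λ z → z ℤ.- ι f ℤ.+ ι t ℤ.- ι 1) (ι-minus (A + 1 + f) d n-d≡A+1+f))
             (trans (cong (λ z → z ℤ.+ ι t ℤ.- ι 1) (ι-minus (A + 1) f refl))
               (trans (cong (ℤ._- ι 1) (sym (ℤ.pos-+ (A + 1) t))) (ι-minus A′ 1 (shift c e′ t))))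
        where
        shift : ∀ c e′ t → c + e′ + suc (e′ + t) + 1 + t ≡ c + e′ + (suc (e′ + t) + t) + 1
        shift = solve-∀

      z₈ : ι e ℤ.- ι f ℤ.+ ι 2 ℤ.* ι t ℤ.- ι 1 ≡ ι (r + t)
      z₈ = trans (cong₂ (λ u v → u ℤ.+ v ℤ.- ι 1) e-f (sym (ℤ.pos-* 2 t)))
             (trans (cong (ℤ._- ι 1) (sym (ℤ.pos-+ (1 + e′) (2 * t)))) (ι-minus (r + t) 1 (shift e′ t)))
        where
        shift : ∀ e′ t → 1 + e′ + 2 * t ≡ e′ + t + t + 1
        shift = solve-∀

    ρ : ℚ
    ρ = recip (+ suc (c + e′))

    private
      N!≡ : N ! ≡ B * (d ! * K !)
      N!≡ = trans (cong _! (shift c d e′ f t)) (sym (binomial-! d K))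
        where
        shift : ∀ c d e′ f t → f + t + 1 + (c + d + (e′ + e′)) ≡ d + (c + (e′ + e′) + f + t + 1)
        shift = solve-∀

      fromℕ-product : ∀ {k x y} → k ≡ x * y → fromℕ k ≡ fromℕ x ℚ.* fromℕ y
      fromℕ-product {x = x} {y} refl = fromℕ-* x y

      cancel-factorials : ∀ ν P Q → P ! ≡ ν * (c ! * e′ ! * Q !) →
        fct (+ N) ℚ.* fct (+ P) ℚ.* ρ ℚ.* invFct (+ c) ℚ.* invFct (+ d) ℚ.* invFct (+ K) ℚ.* invFct (+ Q)
          ℚ.* invFct (+ e′) ≡ fromℕ B ℚ.* fromℕ ν ℚ.* ρ
      cancel-factorials ν P Q P!≡ = begin
        fct (+ N) ℚ.* fct (+ P) ℚ.* ρ ℚ.* ic ℚ.* id ℚ.* iK ℚ.* iQ ℚ.* ie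
          ≡⟨ cong₂ (λ x y → x ℚ.* y ℚ.* ρ ℚ.* ic ℚ.* id ℚ.* iK ℚ.* iQ ℚ.* ie)
                   (trans (fct≡fromℕ! N) (trans (fromℕ-product N!≡) (cong (fromℕ B ℚ.*_) (fromℕ-* (d !) (K !)))))
                   (trans (fct≡fromℕ! P) (trans (fromℕ-product P!≡) (cong (fromℕ ν ℚ.*_)
                     (trans (fromℕ-* (c ! * e′ !) (Q !)) (cong (ℚ._* fromℕ (Q !)) (fromℕ-* (c !) (e′ !))))))) ⟩
        fromℕ B ℚ.* (fd ℚ.* fK) ℚ.* (fromℕ ν ℚ.* (fc ℚ.* fe ℚ.* fQ)) ℚ.* ρ ℚ.* ic ℚ.* id ℚ.* iK ℚ.* iQ
          ℚ.* ie
          ≡⟨ regroup (fromℕ B) (fromℕ ν) ρ fc fd fe fK fQ ic id ie iK iQ ⟩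
        fromℕ B ℚ.* fromℕ ν ℚ.* ρ
          ℚ.* ((id ℚ.* fd) ℚ.* (iK ℚ.* fK) ℚ.* (ic ℚ.* fc) ℚ.* (ie ℚ.* fe) ℚ.* (iQ ℚ.* fQ))
          ≡⟨ cong (fromℕ B ℚ.* fromℕ ν ℚ.* ρ ℚ.*_)
                  (all-one (invFct*fromℕ! d) (invFct*fromℕ! K) (invFct*fromℕ! c) (invFct*fromℕ! e′)
                           (invFct*fromℕ! Q)) ⟩
        fromℕ B ℚ.* fromℕ ν ℚ.* ρ ℚ.* 1ℚ
          ≡⟨ ℚ.*-identityʳ _ ⟩
        fromℕ B ℚ.* fromℕ ν ℚ.* ρ ∎
        where
        open ≡-Reasoning
        fc = fromℕ (c !)
        fd = fromℕ (d !)
        fe = fromℕ (e′ !)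
        fK = fromℕ (K !)
        fQ = fromℕ (Q !)
        ic = invFct (+ c)
        id = invFct (+ d)
        ie = invFct (+ e′)
        iK = invFct (+ K)
        iQ = invFct (+ Q)
        regroup : ∀ b ν ρ fc fd fe fK fQ ic id ie iK iQ →
          b ℚ.* (fd ℚ.* fK) ℚ.* (ν ℚ.* (fc ℚ.* fe ℚ.* fQ)) ℚ.* ρ ℚ.* ic ℚ.* id ℚ.* iK ℚ.* iQ ℚ.* ie ≡
          b ℚ.* ν ℚ.* ρ ℚ.* ((id ℚ.* fd) ℚ.* (iK ℚ.* fK) ℚ.* (ic ℚ.* fc) ℚ.* (ie ℚ.* fe) ℚ.* (iQ ℚ.* fQ))
        regroup = ring-solve-∀ ℚ-almostCommutativeRing
        all-one : ∀ {p q r s u} → p ≡ 1ℚ → q ≡ 1ℚ → r ≡ 1ℚ → s ≡ 1ℚ → u ≡ 1ℚ →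
                  p ℚ.* q ℚ.* r ℚ.* s ℚ.* u ≡ 1ℚ
        all-one refl refl refl refl refl = refl

    opaque
      unfolding rhsShape

      rhsShape-on-support : rhsShape c d (+ N) (+ A) (+ suc (c + e′)) (+ K) (+ r) (+ e′) (+ A′) (+ (r + t)) ≡
                            ℚ.- (fromℕ B ℚ.* fromℕ S)
      rhsShape-on-support = begin
        _ ≡⟨ cong₂ ℚ._-_ (cancel-factorials ν₀ A r (trinomial-!-suc c e′ r))
                         (cancel-factorials νₜ A′ (r + t) (trinomial-!-suc c e′ (r + t))) ⟩
        fromℕ B ℚ.* fromℕ ν₀ ℚ.* ρ ℚ.- fromℕ B ℚ.* fromℕ νₜ ℚ.* ρ
          ≡⟨ cong (λ x → fromℕ B ℚ.* fromℕ ν₀ ℚ.* ρ ℚ.- fromℕ B ℚ.* x ℚ.* ρ) νₜ-telescoped ⟩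
        fromℕ B ℚ.* fromℕ ν₀ ℚ.* ρ ℚ.- fromℕ B ℚ.* (fromℕ (suc (c + e′)) ℚ.* fromℕ S ℚ.+ fromℕ ν₀)
          ℚ.* ρ
          ≡⟨ collect (fromℕ B) (fromℕ ν₀) (fromℕ S) (fromℕ (suc (c + e′))) ρ ⟩
        ℚ.- (fromℕ B ℚ.* fromℕ S ℚ.* (ρ ℚ.* fromℕ (suc (c + e′))))
          ≡⟨ cong (λ x → ℚ.- (fromℕ B ℚ.* fromℕ S ℚ.* x)) (1/n*fromℕ-n (suc (c + e′))) ⟩
        ℚ.- (fromℕ B ℚ.* fromℕ S ℚ.* 1ℚ)
          ≡⟨ cong ℚ.-_ (ℚ.*-identityʳ _) ⟩
        ℚ.- (fromℕ B ℚ.* fromℕ S) ∎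
        where
        open ≡-Reasoning
        ν₀ νₜ : ℕ
        ν₀ = trinomial c e′ R * R
        νₜ = trinomial c e′ (R + t) * (R + t)
        νₜ-telescoped : fromℕ νₜ ≡ fromℕ (suc (c + e′)) ℚ.* fromℕ S ℚ.+ fromℕ ν₀
        νₜ-telescoped = trans (cong fromℕ (sym (trinomial-telescope c e′ R t)))
          (trans (fromℕ-+ _ ν₀) (cong (ℚ._+ fromℕ ν₀) (fromℕ-product (cong (_* S) (+-comm (c + e′) 1)))))
        collect : ∀ b ν s k ρ →
                  b ℚ.* ν ℚ.* ρ ℚ.- b ℚ.* (k ℚ.* s ℚ.+ ν) ℚ.* ρ ≡ ℚ.- (b ℚ.* s ℚ.* (ρ ℚ.* k))
        collect = ring-solve-∀ ℚ-almostCommutativeRing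

    rhsTerm-on-support : rhsTerm n f t c d e ≡ ℚ.- (fromℕ B ℚ.* fromℕ S)
    rhsTerm-on-support = trans (rhsTerm≡rhsShape n f t c d e z₁ z₂ z₃ z₄ z₅ z₆ z₇ z₈) rhsShape-on-support

module CoefficientExtraction where

  open import Defs using (rhs; rhsTerm; ι)
  open Shifts
  open ClosedForm
  open NaturalRationals
  open WMVCoefficients using (wmvCoefficient)
  open Multinomials using (binomial; trinomial)
  open RightHandSide
  open import Algebra.Bundles using (CommutativeRing)
  import Data.Integer as ℤ
  import Data.Integer.Properties as ℤ
  open import Data.Integer.Tactic.RingSolver using () renaming (solve-∀ to ℤ-solve-∀)
  open import Data.Nat as ℕ using (ℕ; zero; suc; _+_; _*_; _∸_; _≤_; _<_; _<?_; _≤?_; s≤s)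
  open import Data.Nat.Properties
  open import Data.Nat.Tactic.RingSolver using (solve-∀)
  open import Data.Product using (_,_)
  open import Data.Rational as ℚ using (ℚ; 0ℚ)
  open import Relation.Nullary using (yes; no)
  open import Relation.Binary.PropositionalEquality
    using (_≡_; _≢_; refl; cong; cong₂; trans; sym; subst; module ≡-Reasoning)
  private
    module ℚΣ = FiniteSums (CommutativeRing.commutativeSemiring SeriesRing.ℚ-ring)
    module ℕΣ = FiniteSums +-*-commutativeSemiring

  shiftedClosedForm-small-α : ∀ f t j n c d e → e < f + 1 → shiftedClosedForm f t j n c d e ≡ 0ℚ
  shiftedClosedForm-small-α f t j n c d e e<f+1 with n <? f + t + 2
  ... | yes n<f+t+2 = shiftZ^-< (f + t + 2) _ n c d e n<f+t+2
  ... | no  n≮f+t+2 with m≤n⇒∃[o]m+o≡n (≮⇒≥ n≮f+t+2)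
  ...   | m , refl = trans (shiftZ^-+ (f + t + 2) _ m c d e) (shiftA^-< (f + 1) _ m c d e e<f+1)

  shiftedClosedForm-off-support : ∀ f t j n c d e → c + d + 2 * e + t ≢ n + f → shiftedClosedForm f t j n c d e ≡ 0ℚ
  shiftedClosedForm-off-support f t j n c d e off with n <? f + t + 2 | e <? f + 1
  ... | yes n<f+t+2 | _       = shiftZ^-< (f + t + 2) _ n c d e n<f+t+2
  ... | no  _       | yes e<f+1 = shiftedClosedForm-small-α f t j n c d e e<f+1
  ... | no  n≮f+t+2 | no e≮f+1 with m≤n⇒∃[o]m+o≡n (≮⇒≥ n≮f+t+2) | m≤n⇒∃[o]m+o≡n (≮⇒≥ e≮f+1)
  ...   | m , refl | e′ , refl = trans (shiftZ^-+ (f + t + 2) _ m c d (f + 1 + e′))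
          (trans (shiftA^-+ (f + 1) _ m c d e′) (ifEq-≢ m (c + d + (e′ + e′)) _
            (λ m≡ → off (trans (shift c d e′ f t) (cong (λ z → f + t + 2 + z + f) (sym m≡))))))
    where
    shift : ∀ c d e′ f t → c + d + 2 * (f + 1 + e′) + t ≡ f + t + 2 + (c + d + (e′ + e′)) + f
    shift = solve-∀

  shiftedClosedForm-on-support : ∀ f t j c d e′ →
    shiftedClosedForm f t j (f + t + 2 + (c + d + (e′ + e′))) c d (f + 1 + e′)
      ≡ fromℕ (wmvCoefficient (f ∸ j) (t + j + 1) c d e′)
  shiftedClosedForm-on-support f t j c d e′ =
    trans (shiftZ^-+ (f + t + 2) _ (c + d + (e′ + e′)) c d (f + 1 + e′))
      (trans (shiftA^-+ (f + 1) _ (c + d + (e′ + e′)) c d e′) (ifEq-self (c + d + (e′ + e′)) _))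

  fromℕ-sumBelow : ∀ t (h : ℕ → ℕ) → ℚΣ.sumBelow t (λ j → fromℕ (h j)) ≡ fromℕ (ℕΣ.sumBelow t h)
  fromℕ-sumBelow zero    h = sym fromℕ-0
  fromℕ-sumBelow (suc t) h = trans (cong (ℚ._+ fromℕ (h t)) (fromℕ-sumBelow t h)) (sym (fromℕ-+ (ℕΣ.sumBelow t h) (h t)))

  module _ (c d e′ f t : ℕ) (t<f : t < f) where
    open OnSupport c d e′ f t using (B; S; R; rhsTerm-on-support)

    wmvCoefficients-on-support : ℕΣ.sumBelow t (λ j → wmvCoefficient (f ∸ j) (t + j + 1) c d e′) ≡ B * S
    wmvCoefficients-on-support =
      trans (ℕΣ.sumBelow-cong t wmvCoefficient-on-support) (sym (ℕΣ.*-distribˡ-sumBelow t B _))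
      where
      wmvCoefficient-on-support : ∀ j → j < t → wmvCoefficient (f ∸ j) (t + j + 1) c d e′ ≡ B * trinomial c e′ (R + j)
      wmvCoefficient-on-support j j<t with m≤n⇒∃[o]m+o≡n (≤-trans (<⇒≤ j<t) (<⇒≤ t<f))
      ... | u , refl = cong₂ (λ x y → binomial d x * trinomial c e′ y)
                             (trans (cong ((c + e′ + (e′ + (t + j + 1))) +_) (m+n∸m≡n j u)) (shift-K c e′ j u t))
                             (shift-R e′ t j)
        where
        shift-K : ∀ c e′ j u t → c + e′ + (e′ + (t + j + 1)) + u ≡ c + (e′ + e′) + (j + u) + t + 1
        shift-K = solve-∀
        shift-R : ∀ e′ t j → e′ + (t + j + 1) ≡ suc (e′ + t) + j
        shift-R = solve-∀

    coefficient-sum-on-support :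
      ℚ.- ℚΣ.sumBelow t (λ j → shiftedClosedForm f t j (f + t + 2 + (c + d + (e′ + e′))) c d (f + 1 + e′))
        ≡ rhsTerm (f + t + 2 + (c + d + (e′ + e′))) f t c d (f + 1 + e′)
    coefficient-sum-on-support = trans (cong ℚ.-_ (begin
      ℚΣ.sumBelow t (λ j → shiftedClosedForm f t j _ c d _)
        ≡⟨ ℚΣ.sumBelow-cong t (λ j _ → shiftedClosedForm-on-support f t j c d e′) ⟩
      ℚΣ.sumBelow t (λ j → fromℕ (wmvCoefficient (f ∸ j) (t + j + 1) c d e′))
        ≡⟨ fromℕ-sumBelow t _ ⟩
      fromℕ (ℕΣ.sumBelow t (λ j → wmvCoefficient (f ∸ j) (t + j + 1) c d e′))
        ≡⟨ cong fromℕ wmvCoefficients-on-support ⟩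
      fromℕ (B * S)
        ≡⟨ fromℕ-* B S ⟩
      fromℕ B ℚ.* fromℕ S ∎)) (sym rhsTerm-on-support)
      where open ≡-Reasoning

  coefficient-sum≡rhsTerm : ∀ n f t c d e → t < f → c + d + 2 * e + t ≡ n + f →
    ℚ.- ℚΣ.sumBelow t (λ j → shiftedClosedForm f t j n c d e) ≡ rhsTerm n f t c d e
  coefficient-sum≡rhsTerm n f t c d e t<f on with e ≤? f
  ... | yes e≤f with m≤n⇒∃[o]m+o≡n e≤f
  ...   | u , refl = trans (cong ℚ.-_ (ℚΣ.sumBelow-zero t (λ j _ → shiftedClosedForm-small-α (e + u) t j n c d e e<f+1)))
                           (sym (rhsTerm-vanishes n e u t c d))
    where
    e<f+1 : e < e + u + 1
    e<f+1 = subst (e <_) (sym (+-comm (e + u) 1)) (s≤s e≤f)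
  coefficient-sum≡rhsTerm n f t c d e t<f on | no e≰f with m≤n⇒∃[o]m+o≡n (subst (_≤ e) (+-comm 1 f) (≰⇒> e≰f))
  ... | e′ , refl with +-cancelʳ-≡ f n (f + t + 2 + (c + d + (e′ + e′))) (trans (sym on) (shift c d e′ f t))
    where
    shift : ∀ c d e′ f t → c + d + 2 * (f + 1 + e′) + t ≡ f + t + 2 + (c + d + (e′ + e′)) + f
    shift = solve-∀
  ... | refl = coefficient-sum-on-support c d e′ f t t<f

  private
    ℕ⇒ℤ-support : ∀ x t f n → x + t ≡ n + f → ι x ℤ.+ (ι t ℤ.- ι f) ≡ ι n
    ℕ⇒ℤ-support x t f n x+t≡n+f = begin
      ι x ℤ.+ (ι t ℤ.- ι f)   ≡⟨ assoc (ι x) (ι t) (ι f) ⟩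
      ι x ℤ.+ ι t ℤ.- ι f     ≡⟨ cong (ℤ._- ι f) (sym (ℤ.pos-+ x t)) ⟩
      ι (x + t) ℤ.- ι f       ≡⟨ ι-minus n f x+t≡n+f ⟩
      ι n                     ∎
      where
      open ≡-Reasoning
      assoc : ∀ a b c → a ℤ.+ (b ℤ.- c) ≡ a ℤ.+ b ℤ.- c
      assoc = ℤ-solve-∀

    ℤ⇒ℕ-support : ∀ x t f n → ι x ℤ.+ (ι t ℤ.- ι f) ≡ ι n → x + t ≡ n + f
    ℤ⇒ℕ-support x t f n on = ℤ.+-injective (begin
      ι (x + t)                       ≡⟨ ℤ.pos-+ x t ⟩
      ι x ℤ.+ ι t                     ≡⟨ rearrange (ι x) (ι t) (ι f) ⟩
      ι x ℤ.+ (ι t ℤ.- ι f) ℤ.+ ι f   ≡⟨ cong (ℤ._+ ι f) on ⟩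
      ι n ℤ.+ ι f                     ≡⟨ sym (ℤ.pos-+ n f) ⟩
      ι (n + f)                       ∎)
      where
      open ≡-Reasoning
      rearrange : ∀ a b c → a ℤ.+ b ≡ a ℤ.+ (b ℤ.- c) ℤ.+ c
      rearrange = ℤ-solve-∀

  coefficient-sum≡rhs : ∀ n f t c d e → t < f →
    ℚ.- ℚΣ.sumBelow t (λ j → shiftedClosedForm f t j n c d e) ≡ rhs n f t c d e
  coefficient-sum≡rhs n f t c d e t<f with ℤ._≟_ (ℤ._+_ (ι (c + d + 2 * e)) (ℤ._-_ (ι t) (ι f))) (ι n)
  ... | yes on  = coefficient-sum≡rhsTerm n f t c d e t<f (ℤ⇒ℕ-support _ t f n on)
  ... | no  off = cong ℚ.-_ (ℚΣ.sumBelow-zero t (λ j _ →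
                    shiftedClosedForm-off-support f t j n c d e (λ on → off (ℕ⇒ℤ-support _ t f n on))))

module RingForm where

  open import Defs
  open import Algebra.Bundles using (CommutativeRing)
  open SeriesRing
  open import Data.Nat using (_+_; _∸_)
  open import Relation.Binary.PropositionalEquality using (refl; cong₂; trans; sym)
  import Data.Rational as ℚ
  private
    module S = CommutativeRing Series
  open import Algebra.Properties.Semiring.Exp (CommutativeRing.semiring Series) using () renaming (_^_ to _^ᴿ_)

  opaque
    unfolding _+ˢ_ _*ˢ_ -ˢ_ 0ˢ 1ˢ

    functionalEquations-ringForm : ∀ M W V → M ≈ 𝟙 ⊕ (Xs ⊕ Ys) ⊗ Zs ⊗ M ⊕ As ⊗ (Zs ^ 2) ⊗ (M ^ 2) →
      W ⊗ (𝟙 ⊖ Ys ⊗ Zs) ≈ 𝟙 → V ⊗ (𝟙 ⊖ As ⊗ (Zs ^ 2) ⊗ (M ^ 2)) ≈ 𝟙 → MWV.FunctionalEquations M W V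
    functionalEquations-ringForm M W V hM hW hV = record { M-eq = hM ; W-inv = hW ; V-inv = hV }

    Q-ringForm : ∀ M W t Q → Q ⊗ (Xs ⊕ As ⊗ Zs ⊗ M) ≈ (Zs ⊗ W) ^ t ⊖ (Zs ⊗ M) ^ t →
                 Q S.* (Xs S.+ As S.* Zs S.* M) ≈ (Zs S.* W) ^ᴿ t S.- (Zs S.* M) ^ᴿ t
    Q-ringForm M W t Q h n a b c =
      trans (h n a b c) (cong₂ ℚ._-_ (^≈^ˢ (Zs ⊗ W) t n a b c) (^≈^ˢ (Zs ⊗ M) t n a b c))

    Q-fromRingForm : ∀ M W t Q → Q S.* (Xs S.+ As S.* Zs S.* M) ≈ (Zs S.* W) ^ᴿ t S.- (Zs S.* M) ^ᴿ t →
                     Q ⊗ (Xs ⊕ As ⊗ Zs ⊗ M) ≈ (Zs ⊗ W) ^ t ⊖ (Zs ⊗ M) ^ t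
    Q-fromRingForm M W t Q h n a b c =
      trans (h n a b c) (sym (cong₂ ℚ._-_ (^≈^ˢ (Zs ⊗ W) t n a b c) (^≈^ˢ (Zs ⊗ M) t n a b c)))

    lhs-ringForm : ∀ M W V Q f t →
      (As ^ (f + 1)) ⊗ ((Zs ⊗ W) ^ (f ∸ t)) ⊗ Q ⊗ ((Zs ⊗ M) ^ (t + 1)) ⊗ V ≈
      As ^ᴿ (f + 1) S.* (Zs S.* W) ^ᴿ (f ∸ t) S.* Q S.* (Zs S.* M) ^ᴿ (t + 1) S.* V
    lhs-ringForm M W V Q f t =
      ⊗-cong {G = V} (⊗-cong (⊗-cong {G = Q} (⊗-cong (^≈^ˢ As (f + 1)) (^≈^ˢ (Zs ⊗ W) (f ∸ t)))
                                             (λ _ _ _ _ → refl))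
                             (^≈^ˢ (Zs ⊗ M) (t + 1)))
                     (λ _ _ _ _ → refl)

open import Defs
open import Data.Nat using (ℕ; _≤_; _<_; _+_; _∸_)
open import Data.Product using (Σ; _×_; _,_)
open import Relation.Binary.PropositionalEquality using (_≡_; trans)
open RingForm
open CoefficientExtraction using (coefficient-sum≡rhs)

lemma23 : (n f t : ℕ) → 1 ≤ n → 1 ≤ f → t < f →
    (M : Ser) → M ≈ 𝟙 ⊕ (Xs ⊕ Ys) ⊗ Zs ⊗ M ⊕ As ⊗ (Zs ^ 2) ⊗ (M ^ 2) →
    (W : Ser) → W ⊗ (𝟙 ⊖ Ys ⊗ Zs) ≈ 𝟙 →
    (V : Ser) → V ⊗ (𝟙 ⊖ As ⊗ (Zs ^ 2) ⊗ (M ^ 2)) ≈ 𝟙 →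
    Σ Ser (λ Q → Q ⊗ (Xs ⊕ As ⊗ Zs ⊗ M) ≈ (Zs ⊗ W) ^ t ⊖ (Zs ⊗ M) ^ t)
    ×
    ((Q : Ser) → Q ⊗ (Xs ⊕ As ⊗ Zs ⊗ M) ≈ (Zs ⊗ W) ^ t ⊖ (Zs ⊗ M) ^ t →
      ∀ c d e →
        ⟨z^ n ⟩ ((As ^ (f + 1)) ⊗ ((Zs ⊗ W) ^ (f ∸ t)) ⊗ Q
                  ⊗ ((Zs ⊗ M) ^ (t + 1)) ⊗ V) c d e
        ≡ rhs n f t c d e)
lemma23 n f t _ _ t<f M hM W hW V hV =
    (Q₀ t , Q-fromRingForm M W t (Q₀ t) (Q₀*D t))
  , λ Q hQ c d e → trans (lhs-ringForm M W V Q f t n c d e)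
                   (trans (lhs-coefficient f t t<f Q (Q-ringForm M W t Q hQ) n c d e)
                          (coefficient-sum≡rhs n f t c d e t<f))
  where
  open GeneratingFunctions M W V (functionalEquations-ringForm M W V hM hW hV)
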